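{- Let $\lambda$ be a strict partition with $n$ parts and let $n\le k\le\lambda_1$. Then \[ g^\lambda_k(+1)=\sum_{(i,j)\in\mathrm{NE}(\lambda),\ j>k}g^{\lambda\cup\{(i,j)\}}. \]
   Context: For a strict partition $\lambda=(\lambda_1>\dots>\lambda_n>0)$, the shifted diagram is $\{(i,j):1\le i\le n,\ i\le j\le\lambda_i+i-1\}$ ($i$ = row, $j$ = column). A standard Young tableau of shifted shape $\lambda$ is a filling with $1,\dots,|\lambda|$, each once, increasing along rows and columns; $g^\lambda$ is their number. A standard barely set-valued tableau (SBT) of shifted shape $\lambda$ is a filling with the integers $1,\dots,|\lambda|+1$, each used once, every cell containing one integer except one cell (the double cell) containing two, such that every entry of a cell is smaller than every entry of the cell to its right and of the cell below it. $g^\lambda_k(+1)$ is the number of SBTs of shifted shape $\lambda$ whose double cell lies in column $k$. $\mathrm{NE}(\lambda)$ is the set of cells $(i,i+\lambda_i)$ with $1\le i\le n$ and $\lambda_i\le\lambda_{i-1}-2$ (where $\lambda_0=\infty$); for $(i,j)\in\mathrm{NE}(\lambda)$, $\lambda\cup\{(i,j)\}$ is the shifted diagram of the strict partition obtained from $\lambda$ by increasing $\lambda_i$ by $1$. -}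

module Defs where

open import Data.Nat using (ℕ; zero; suc; _+_; _<_; _>_; _≡ᵇ_; _<ᵇ_; _≤ᵇ_; _<?_)
open import Data.Bool using (Bool; true; false; _∧_; _∨_; not; if_then_else_)
open import Data.List using (List; []; _∷_; _++_; map; concatMap; length; applyUpTo; upTo; zip; filter)
open import Data.List.Relation.Unary.All using (All)
open import Data.List.Relation.Unary.Linked using (Linked)
open import Data.Nat.ListAction using (sum)
open import Data.Product using (_×_; _,_; proj₁; proj₂)

IsStrictPartition : List ℕ → Set
IsStrictPartition la = All (λ p → 0 < p) la × Linked _>_ la

-- Cells (i , j): i = row, j = column, both 1-indexed.
Cell : Set
Cell = ℕ × ℕ

row col : Cell → ℕ
row = proj₁
col = proj₂

shiftedFrom : ℕ → List ℕ → List Cell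
shiftedFrom i [] = []
shiftedFrom i (l ∷ ls) = applyUpTo (λ t → (i , i + t)) l ++ shiftedFrom (suc i) ls

shiftedDiagram : List ℕ → List Cell
shiftedDiagram la = shiftedFrom 1 la

_==ᶜ_ : Cell → Cell → Bool
(i , j) ==ᶜ (i' , j') = (i ≡ᵇ i') ∧ (j ≡ᵇ j')

rightOrBelow : Cell → Cell → Bool
rightOrBelow (i , j) d = (d ==ᶜ (i , suc j)) ∨ (d ==ᶜ (suc i , j))

allB : {A : Set} → (A → Bool) → List A → Bool
allB p [] = true
allB p (x ∷ xs) = p x ∧ allB p xs

countB : {A : Set} → (A → Bool) → List A → ℕ
countB p [] = 0
countB p (x ∷ xs) = if p x then suc (countB p xs) else countB p xs

-- A filling by the integers 1, …, N in which every integer is used exactly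
-- once is encoded by the list  f = [c₁, …, c_N]  where c_v is the cell
-- containing the integer v.  (The content of a cell c is {v | c_v = c}.)
Filling : Set
Filling = List Cell

fillings : List Cell → ℕ → List Filling
fillings D zero = [] ∷ []
fillings D (suc N) = concatMap (λ c → map (c ∷_) (fillings D N)) D

mult : Filling → Cell → ℕ
mult f c = countB (λ d → d ==ᶜ c) f

indexed : Filling → List (ℕ × Cell)
indexed f = zip (applyUpTo suc (length f)) f

increasing : Filling → Bool
increasing f =
  allB (λ a → allB (λ b → not (rightOrBelow (proj₂ a) (proj₂ b)) ∨ (proj₁ a <ᵇ proj₁ b))
                   (indexed f))
       (indexed f)

isSYT : List Cell → Filling → Bool
isSYT D f = allB (λ c → mult f c ≡ᵇ 1) D ∧ increasing f

g : List ℕ → ℕ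
g la = countB (isSYT (shiftedDiagram la)) (fillings (shiftedDiagram la) (sum la))

isSBTcol : ℕ → List Cell → Filling → Bool
isSBTcol k D f =
  allB (λ c → (mult f c ≡ᵇ 1) ∨ (mult f c ≡ᵇ 2)) D
  ∧ (countB (λ c → mult f c ≡ᵇ 2) D ≡ᵇ 1)
  ∧ allB (λ c → not (mult f c ≡ᵇ 2) ∨ (col c ≡ᵇ k)) D
  ∧ increasing f

gPlus : List ℕ → ℕ → ℕ
gPlus la k = countB (isSBTcol k (shiftedDiagram la))
                    (fillings (shiftedDiagram la) (suc (sum la)))

-- NE(λ): cells (i , i + λᵢ) with λᵢ ≤ λ_{i-1} - 2  (λ₀ = ∞)
neFrom : ℕ → ℕ → List ℕ → List Cell
neFrom i prev [] = []
neFrom i prev (l ∷ ls) =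
  (if (l + 2) ≤ᵇ prev then (i , i + l) ∷ [] else []) ++ neFrom (suc i) l ls

NE : List ℕ → List Cell
NE [] = []
NE (l ∷ ls) = (1 , 1 + l) ∷ neFrom 2 l ls

-- λ ∪ {(i , j)} for (i , j) ∈ NE(λ): increase λᵢ by one
incPart : ℕ → List ℕ → List ℕ
incPart i [] = []
incPart zero (l ∷ ls) = l ∷ ls
incPart (suc zero) (l ∷ ls) = suc l ∷ ls
incPart (suc (suc i)) (l ∷ ls) = l ∷ incPart (suc i) ls

addCell : List ℕ → Cell → List ℕ
addCell la c = incPart (row c) la

neSum : List ℕ → ℕ → ℕ
neSum la k = sum (map (λ c → g (addCell la c)) (filter (λ c → k <? col c) (NE la)))

-- Removing the largest entry N+1 of a tableau of shifted shape λ leaves a tableau of shape λ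
-- minus the corner c that held it.  For an SBT, either c held only N+1, leaving an SBT of
-- shape λ − c, or c is the double cell, leaving an SYT of shape λ; the latter requires c to lie
-- in column k.  Hence g⁺ₖ(λ) = Σ_c (g⁺ₖ(λ − c) + [col c = k] g^λ) and, likewise,
-- g^μ = Σ_c g^(μ − c).  By induction on |λ| the first sum becomes Σ_c Σ_e g^(λ − c + e) over
-- corners c of λ and NE cells e of λ − c in columns > k, while expanding each g^(λ + e) on the
-- right-hand side gives Σ_e Σ_c g^(λ + e − c).  Adding an NE cell and removing a corner in
-- different rows commute, so the two double sums differ only on the diagonal, and what is left
-- is the count  #{NE cells in columns > k} = #{corners in columns ≥ k},  which telescopes over
-- consecutive rows as soon as k ≥ n.

module Submission where

open import Defs
open import Data.Bool using (Bool; true; false; _∧_; _∨_; not; T; if_then_else_)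
open import Data.Bool.Properties using (∧-identityʳ; ∨-identityʳ; ∧-zeroʳ; ∧-assoc; ∧-comm; ¬-not)
open import Data.Empty using (⊥; ⊥-elim)
open import Data.List using (List; []; _∷_; _++_; map; concatMap; length; applyUpTo; zip; filter; _∷ʳ_; [_])
open import Data.List.Membership.Propositional using (_∈_; _∉_; find)
open import Data.List.Membership.Propositional.Properties
  using (∈-applyUpTo⁺; ∈-applyUpTo⁻; ∈-++⁺ˡ; ∈-++⁺ʳ; ∈-++⁻; ∈-map⁻; ∈-concatMap⁻)
open import Data.List.Properties using (++-assoc; applyUpTo-∷ʳ; length-applyUpTo)
open import Data.List.Relation.Unary.Any using (here; there)
open import Data.List.Relation.Unary.Linked using (Linked; []; [-]; _∷_)
open import Data.Nat
  using (ℕ; zero; suc; _+_; _*_; _∸_; _≤_; _<_; _>_; z≤n; s≤s; _≡ᵇ_; _<ᵇ_; _≤ᵇ_; _<?_; _≤?_; pred)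
open import Data.Nat.ListAction using (sum)
open import Data.Nat.Properties
open import Algebra.Properties.CommutativeSemigroup +-commutativeSemigroup using (interchange)
open import Data.Product using (_×_; _,_; proj₁; proj₂; ∃)
open import Data.Sum using (_⊎_; inj₁; inj₂; [_,_]′)
open import Data.Unit using (tt)
open import Function using (_∘_; _∘′_)
open import Relation.Nullary using (yes; no)
open import Relation.Binary.PropositionalEquality hiding ([_])

∧-elimˡ : ∀ {a b} → a ∧ b ≡ true → a ≡ true
∧-elimˡ {true} _ = refl

∧-elimʳ : ∀ {a b} → a ∧ b ≡ true → b ≡ true
∧-elimʳ {true} p = p

∧-intro : ∀ {a b} → a ≡ true → b ≡ true → a ∧ b ≡ true
∧-intro refl refl = refl

∨-elim : ∀ {a b} → a ∨ b ≡ true → a ≡ true ⊎ b ≡ true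
∨-elim {true} _ = inj₁ refl
∨-elim {false} p = inj₂ p

∨-introˡ : ∀ {a b} → a ≡ true → a ∨ b ≡ true
∨-introˡ refl = refl

∨-introʳ : ∀ {a b} → b ≡ true → a ∨ b ≡ true
∨-introʳ {true} _ = refl
∨-introʳ {false} p = p

≡-fromTrue : ∀ {a b} → (a ≡ true → b ≡ true) → (b ≡ true → a ≡ true) → a ≡ b
≡-fromTrue {true} f _ = sym (f refl)
≡-fromTrue {false} {true} _ g = g refl
≡-fromTrue {false} {false} _ _ = refl

true≢false : true ≢ false
true≢false ()

fromT : ∀ {b} → T b → b ≡ true
fromT {true} _ = refl

toT : ∀ {b} → b ≡ true → T b
toT refl = tt

≡ᵇ-sound : ∀ {m n} → (m ≡ᵇ n) ≡ true → m ≡ n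
≡ᵇ-sound {m} {n} p = ≡ᵇ⇒≡ m n (toT p)

≡ᵇ-complete : ∀ {m n} → m ≡ n → (m ≡ᵇ n) ≡ true
≡ᵇ-complete {m} {n} e = fromT (≡⇒≡ᵇ m n e)

≡ᵇ-false : ∀ {m n} → m ≢ n → (m ≡ᵇ n) ≡ false
≡ᵇ-false m≢n = ¬-not (λ p → m≢n (≡ᵇ-sound p))

<ᵇ-sound : ∀ {m n} → (m <ᵇ n) ≡ true → m < n
<ᵇ-sound {m} {n} p = <ᵇ⇒< m n (toT p)

<ᵇ-complete : ∀ {m n} → m < n → (m <ᵇ n) ≡ true
<ᵇ-complete m<n = fromT (<⇒<ᵇ m<n)

<ᵇ-false : ∀ {m n} → n ≤ m → (m <ᵇ n) ≡ false
<ᵇ-false n≤m = ¬-not (λ p → <⇒≱ (<ᵇ-sound p) n≤m)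

≤ᵇ-sound : ∀ {m n} → (m ≤ᵇ n) ≡ true → m ≤ n
≤ᵇ-sound {m} {n} p = ≤ᵇ⇒≤ m n (toT p)

≤ᵇ-complete : ∀ {m n} → m ≤ n → (m ≤ᵇ n) ≡ true
≤ᵇ-complete m≤n = fromT (≤⇒≤ᵇ m≤n)

⟦_⟧ : Bool → ℕ
⟦ true ⟧ = 1
⟦ false ⟧ = 0

⟦∧⟧* : ∀ a b x → ⟦ a ∧ b ⟧ * x ≡ ⟦ a ⟧ * (⟦ b ⟧ * x)
⟦∧⟧* true b x = sym (+-identityʳ _)
⟦∧⟧* false b x = refl

⟦<ᵇ⟧+⟦≡ᵇ⟧ : ∀ k m → ⟦ k <ᵇ m ⟧ + ⟦ m ≡ᵇ k ⟧ ≡ ⟦ k <ᵇ suc m ⟧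
⟦<ᵇ⟧+⟦≡ᵇ⟧ zero zero = refl
⟦<ᵇ⟧+⟦≡ᵇ⟧ zero (suc m) = refl
⟦<ᵇ⟧+⟦≡ᵇ⟧ (suc k) zero = refl
⟦<ᵇ⟧+⟦≡ᵇ⟧ (suc k) (suc m) = ⟦<ᵇ⟧+⟦≡ᵇ⟧ k m

==ᶜ-sound : ∀ {c d} → (c ==ᶜ d) ≡ true → c ≡ d
==ᶜ-sound {i , j} {i' , j'} p = cong₂ _,_ (≡ᵇ-sound (∧-elimˡ p)) (≡ᵇ-sound (∧-elimʳ {i ≡ᵇ i'} p))

==ᶜ-refl : ∀ c → (c ==ᶜ c) ≡ true
==ᶜ-refl (i , j) = ∧-intro (≡ᵇ-complete {i} refl) (≡ᵇ-complete {j} refl)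

==ᶜ-false : ∀ {c d} → c ≢ d → (c ==ᶜ d) ≡ false
==ᶜ-false c≢d = ¬-not (λ p → c≢d (==ᶜ-sound p))

rightOrBelow-sound : ∀ c d → rightOrBelow c d ≡ true →
  d ≡ (row c , suc (col c)) ⊎ d ≡ (suc (row c) , col c)
rightOrBelow-sound (i , j) d p with ∨-elim {d ==ᶜ (i , suc j)} p
... | inj₁ q = inj₁ (==ᶜ-sound q)
... | inj₂ q = inj₂ (==ᶜ-sound q)

rightOrBelow-right : ∀ i j → rightOrBelow (i , j) (i , suc j) ≡ true
rightOrBelow-right i j = ∨-introˡ (==ᶜ-refl (i , suc j))

rightOrBelow-below : ∀ i j → rightOrBelow (i , j) (suc i , j) ≡ true
rightOrBelow-below i j = ∨-introʳ {(suc i , j) ==ᶜ (i , suc j)} (==ᶜ-refl (suc i , j))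

rightOrBelow-irrefl : ∀ c → rightOrBelow c c ≡ false
rightOrBelow-irrefl c = ¬-not λ p →
  [ (λ q → 1+n≢n (sym (cong col q))) , (λ q → 1+n≢n (sym (cong row q))) ]′ (rightOrBelow-sound c c p)

∑ : {A : Set} → List A → (A → ℕ) → ℕ
∑ xs f = sum (map f xs)

module _ {A : Set} where

  allB-++ : ∀ (p : A → Bool) xs ys → allB p (xs ++ ys) ≡ allB p xs ∧ allB p ys
  allB-++ p [] ys = refl
  allB-++ p (x ∷ xs) ys rewrite allB-++ p xs ys = sym (∧-assoc (p x) (allB p xs) (allB p ys))

  allB-lookup : ∀ {p : A → Bool} {xs x} → allB p xs ≡ true → x ∈ xs → p x ≡ true
  allB-lookup {p} {y ∷ xs} h (here refl) = ∧-elimˡ h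
  allB-lookup {p} {y ∷ xs} h (there x∈xs) = allB-lookup {p} (∧-elimʳ {p y} h) x∈xs

  allB-tabulate : ∀ {p : A → Bool} xs → (∀ {x} → x ∈ xs → p x ≡ true) → allB p xs ≡ true
  allB-tabulate [] h = refl
  allB-tabulate (x ∷ xs) h = ∧-intro (h (here refl)) (allB-tabulate xs (h ∘′ there))

  allB-cong : ∀ {p q : A → Bool} xs → (∀ {x} → x ∈ xs → p x ≡ q x) → allB p xs ≡ allB q xs
  allB-cong [] h = refl
  allB-cong (x ∷ xs) h = cong₂ _∧_ (h (here refl)) (allB-cong xs (λ m → h (there m)))

  countB-++ : ∀ (p : A → Bool) xs ys → countB p (xs ++ ys) ≡ countB p xs + countB p ys
  countB-++ p [] ys = refl
  countB-++ p (x ∷ xs) ys with p x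
  ... | true = cong suc (countB-++ p xs ys)
  ... | false = countB-++ p xs ys

  countB-none : ∀ {p : A → Bool} xs → (∀ {x} → x ∈ xs → p x ≡ false) → countB p xs ≡ 0
  countB-none [] h = refl
  countB-none {p} (x ∷ xs) h rewrite h (here refl) = countB-none xs (λ m → h (there m))

  countB≡0⇒false : ∀ {p : A → Bool} {xs x} → countB p xs ≡ 0 → x ∈ xs → p x ≡ false
  countB≡0⇒false {p} {y ∷ xs} e m with p y in py
  countB≡0⇒false {p} {y ∷ xs} () m | true
  countB≡0⇒false {p} {y ∷ xs} e (here refl) | false = py
  countB≡0⇒false {p} {y ∷ xs} e (there m) | false = countB≡0⇒false {p} e m

  countB-cong : ∀ {p q : A → Bool} xs → (∀ {x} → x ∈ xs → p x ≡ q x) → countB p xs ≡ countB q xs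
  countB-cong [] h = refl
  countB-cong {p} {q} (x ∷ xs) h rewrite h (here refl) with q x
  ... | true = cong suc (countB-cong xs (λ m → h (there m)))
  ... | false = countB-cong xs (λ m → h (there m))

  countB-split : ∀ (p q : A → Bool) xs →
    countB p xs ≡ countB (λ x → p x ∧ q x) xs + countB (λ x → p x ∧ not (q x)) xs
  countB-split p q [] = refl
  countB-split p q (x ∷ xs) with p x | q x
  ... | true | true = cong suc (countB-split p q xs)
  ... | true | false = trans (cong suc (countB-split p q xs)) (sym (+-suc _ _))
  ... | false | _ = countB-split p q xs

  countB-const∧ : ∀ b (p : A → Bool) xs → countB (λ x → b ∧ p x) xs ≡ ⟦ b ⟧ * countB p xs
  countB-const∧ true p xs = sym (+-identityʳ _)
  countB-const∧ false p xs = countB-none xs (λ _ → refl)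

  ∑-cong : ∀ {f h : A → ℕ} xs → (∀ {x} → x ∈ xs → f x ≡ h x) → ∑ xs f ≡ ∑ xs h
  ∑-cong [] e = refl
  ∑-cong (x ∷ xs) e = cong₂ _+_ (e (here refl)) (∑-cong xs (λ m → e (there m)))

  ∑-++ : ∀ (f : A → ℕ) xs ys → ∑ (xs ++ ys) f ≡ ∑ xs f + ∑ ys f
  ∑-++ f [] ys = refl
  ∑-++ f (x ∷ xs) ys rewrite ∑-++ f xs ys = sym (+-assoc (f x) _ _)

  ∑-+ : ∀ (f h : A → ℕ) xs → ∑ xs (λ x → f x + h x) ≡ ∑ xs f + ∑ xs h
  ∑-+ f h [] = refl
  ∑-+ f h (x ∷ xs) rewrite ∑-+ f h xs = interchange (f x) (h x) (∑ xs f) (∑ xs h)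

  ∑-zero : ∀ (xs : List A) → ∑ xs (λ _ → 0) ≡ 0
  ∑-zero [] = refl
  ∑-zero (x ∷ xs) = ∑-zero xs

∑-comm : ∀ {A B : Set} (h : A → B → ℕ) xs ys →
  ∑ xs (λ x → ∑ ys (h x)) ≡ ∑ ys (λ y → ∑ xs (λ x → h x y))
∑-comm h [] ys = sym (∑-zero ys)
∑-comm h (x ∷ xs) ys rewrite ∑-comm h xs ys = sym (∑-+ (h x) (λ y → ∑ xs (λ x → h x y)) ys)

module _ {X : Set} where

  ∈-++-∷⁻ : ∀ {A B : List X} {c x} → x ∈ A ++ c ∷ B → x ≡ c ⊎ x ∈ A ++ B
  ∈-++-∷⁻ {A} x∈ with ∈-++⁻ A x∈
  ... | inj₁ x∈A = inj₂ (∈-++⁺ˡ x∈A)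
  ... | inj₂ (here x≡c) = inj₁ x≡c
  ... | inj₂ (there x∈B) = inj₂ (∈-++⁺ʳ A x∈B)

  ∈-++-∷⁺ : ∀ {A B : List X} {c x} → x ∈ A ++ B → x ∈ A ++ c ∷ B
  ∈-++-∷⁺ {A} x∈ with ∈-++⁻ A x∈
  ... | inj₁ x∈A = ∈-++⁺ˡ x∈A
  ... | inj₂ x∈B = ∈-++⁺ʳ A (there x∈B)

  allB-++-∷ : ∀ (p : X → Bool) A B c → p c ≡ true → allB p (A ++ c ∷ B) ≡ allB p (A ++ B)
  allB-++-∷ p [] B c pc rewrite pc = refl
  allB-++-∷ p (a ∷ A) B c pc = cong (p a ∧_) (allB-++-∷ p A B c pc)

  countB-++-∷-false : ∀ (p : X → Bool) A B c → p c ≡ false → countB p (A ++ c ∷ B) ≡ countB p (A ++ B)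
  countB-++-∷-false p [] B c pc rewrite pc = refl
  countB-++-∷-false p (a ∷ A) B c pc with p a
  ... | true = cong suc (countB-++-∷-false p A B c pc)
  ... | false = countB-++-∷-false p A B c pc

  countB-++-∷-true : ∀ (p : X → Bool) A B c → p c ≡ true → countB p (A ++ c ∷ B) ≡ suc (countB p (A ++ B))
  countB-++-∷-true p [] B c pc rewrite pc = refl
  countB-++-∷-true p (a ∷ A) B c pc with p a
  ... | true = cong suc (countB-++-∷-true p A B c pc)
  ... | false = countB-++-∷-true p A B c pc

-- Fillings sorted by their largest entry

countB-map : ∀ {A B : Set} (p : B → Bool) (h : A → B) xs → countB p (map h xs) ≡ countB (λ x → p (h x)) xs
countB-map p h [] = refl
countB-map p h (x ∷ xs) with p (h x)
... | true = cong suc (countB-map p h xs)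
... | false = countB-map p h xs

countB-fillings-∷ : ∀ (p : Filling → Bool) D N →
  countB p (fillings D (suc N)) ≡ ∑ D (λ c → countB (λ f → p (c ∷ f)) (fillings D N))
countB-fillings-∷ p D N = go D
  where
    go : ∀ E → countB p (concatMap (λ c → map (c ∷_) (fillings D N)) E)
               ≡ ∑ E (λ c → countB (λ f → p (c ∷ f)) (fillings D N))
    go [] = refl
    go (c ∷ E) = trans (countB-++ p (map (c ∷_) (fillings D N)) _)
                       (cong₂ _+_ (countB-map p (c ∷_) (fillings D N)) (go E))

countLargestAt : (Filling → Bool) → List Cell → ℕ → Cell → ℕ
countLargestAt p D N c = countB (λ f → p (f ∷ʳ c)) (fillings D N)

countB-fillings-∷ʳ : ∀ (p : Filling → Bool) D N →
  countB p (fillings D (suc N)) ≡ ∑ D (countLargestAt p D N)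
countB-fillings-∷ʳ p D zero = countB-fillings-∷ p D zero
countB-fillings-∷ʳ p D (suc N) = begin
    countB p (fillings D (suc (suc N)))
  ≡⟨ countB-fillings-∷ p D (suc N) ⟩
    ∑ D (λ c → countB (λ f → p (c ∷ f)) (fillings D (suc N)))
  ≡⟨ ∑-cong D (λ {c} _ → countB-fillings-∷ʳ (λ f → p (c ∷ f)) D N) ⟩
    ∑ D (λ c → ∑ D (λ c' → countB (λ f → p (c ∷ (f ∷ʳ c'))) (fillings D N)))
  ≡⟨ ∑-comm (λ c c' → countB (λ f → p (c ∷ (f ∷ʳ c'))) (fillings D N)) D D ⟩
    ∑ D (λ c' → ∑ D (λ c → countB (λ f → p (c ∷ (f ∷ʳ c'))) (fillings D N)))
  ≡⟨ ∑-cong D (λ {c'} _ → sym (countB-fillings-∷ (λ f → p (f ∷ʳ c')) D N)) ⟩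
    ∑ D (λ c' → countB (λ f → p (f ∷ʳ c')) (fillings D (suc N)))
  ∎
  where open ≡-Reasoning

countB-fillings-avoiding : ∀ (p : Filling → Bool) A B c N → (∀ f → p f ≡ true → c ∉ f) →
  countB p (fillings (A ++ c ∷ B) N) ≡ countB p (fillings (A ++ B) N)
countB-fillings-avoiding p A B c zero avoid = refl
countB-fillings-avoiding p A B c (suc N) avoid = begin
    countB p (fillings (A ++ c ∷ B) (suc N))
  ≡⟨ countB-fillings-∷ p (A ++ c ∷ B) N ⟩
    ∑ (A ++ c ∷ B) (λ c' → countB (λ f → p (c' ∷ f)) (fillings (A ++ c ∷ B) N))
  ≡⟨ ∑-cong (A ++ c ∷ B) (λ {c'} _ → countB-fillings-avoiding (λ f → p (c' ∷ f)) A B c N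
                                         (λ f pf c∈f → avoid (c' ∷ f) pf (there c∈f))) ⟩
    ∑ (A ++ c ∷ B) G
  ≡⟨ ∑-++ G A (c ∷ B) ⟩
    ∑ A G + (G c + ∑ B G)
  ≡⟨ cong (λ z → ∑ A G + (z + ∑ B G))
          (countB-none (fillings (A ++ B) N) (λ {f} _ → ¬-not (λ pf → avoid (c ∷ f) pf (here refl)))) ⟩
    ∑ A G + ∑ B G
  ≡⟨ sym (∑-++ G A B) ⟩
    ∑ (A ++ B) G
  ≡⟨ sym (countB-fillings-∷ p (A ++ B) N) ⟩
    countB p (fillings (A ++ B) (suc N))
  ∎
  where
    open ≡-Reasoning
    G : Cell → ℕ
    G c' = countB (λ f → p (c' ∷ f)) (fillings (A ++ B) N)

fillings-⊆ : ∀ {D} N {f x} → f ∈ fillings D N → x ∈ f → x ∈ D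
fillings-⊆ zero (here refl) ()
fillings-⊆ {D} (suc N) f∈ x∈f with find (∈-concatMap⁻ (λ c → map (c ∷_) (fillings D N)) {xs = D} f∈)
... | c , c∈D , f∈map with ∈-map⁻ (c ∷_) f∈map
...   | f' , f'∈ , refl with x∈f
...     | here refl = c∈D
...     | there x∈f' = fillings-⊆ N f'∈ x∈f'

∉⇒mult≡0 : ∀ {f c} → c ∉ f → mult f c ≡ 0
∉⇒mult≡0 {f} c∉f = countB-none f (λ d∈f → ==ᶜ-false (λ d≡c → c∉f (subst (_∈ f) d≡c d∈f)))

mult≡0⇒∉ : ∀ {f c} → mult f c ≡ 0 → c ∉ f
mult≡0⇒∉ {d ∷ f} {c} e (here refl) rewrite ==ᶜ-refl c = 0≢1+n (sym e)
mult≡0⇒∉ {d ∷ f} {c} e (there c∈f) with d ==ᶜ c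
... | true = 0≢1+n (sym e)
... | false = mult≡0⇒∉ {f} e c∈f

mult≢0⇒∈ : ∀ {f d} → mult f d ≢ 0 → d ∈ f
mult≢0⇒∈ {[]} ne = ⊥-elim (ne refl)
mult≢0⇒∈ {e ∷ f} {d} ne with e ==ᶜ d in e==d
... | true = here (sym (==ᶜ-sound e==d))
... | false = there (mult≢0⇒∈ {f} ne)

mult-∷ʳ-≢ : ∀ f {c d} → c ≢ d → mult (f ∷ʳ c) d ≡ mult f d
mult-∷ʳ-≢ f {c} {d} c≢d rewrite countB-++ (_==ᶜ d) f [ c ] | ==ᶜ-false c≢d = +-identityʳ _

mult-∷ʳ-≡ : ∀ f c → mult (f ∷ʳ c) c ≡ suc (mult f c)
mult-∷ʳ-≡ f c rewrite countB-++ (_==ᶜ c) f [ c ] | ==ᶜ-refl c = +-comm (mult f c) 1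

zip-applyUpTo-∷ʳ : ∀ (h : ℕ → ℕ) (xs : List Cell) c →
  zip (applyUpTo h (length (xs ∷ʳ c))) (xs ∷ʳ c) ≡ zip (applyUpTo h (length xs)) xs ∷ʳ (h (length xs) , c)
zip-applyUpTo-∷ʳ h [] c = refl
zip-applyUpTo-∷ʳ h (x ∷ xs) c = cong ((h 0 , x) ∷_) (zip-applyUpTo-∷ʳ (λ t → h (suc t)) xs c)

∈-indexed⇒≤length : ∀ {f a} → a ∈ indexed f → proj₁ a ≤ length f
∈-indexed⇒≤length {f} a∈ with ∈-applyUpTo⁻ suc (∈-zip⇒∈ˡ a∈)
  where
    ∈-zip⇒∈ˡ : ∀ {xs : List ℕ} {ys : List Cell} {a} → a ∈ zip xs ys → proj₁ a ∈ xs
    ∈-zip⇒∈ˡ {x ∷ xs} {y ∷ ys} (here refl) = here refl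
    ∈-zip⇒∈ˡ {x ∷ xs} {y ∷ ys} (there a∈) = there (∈-zip⇒∈ˡ a∈)
... | t , t<n , refl = t<n

allB-zip-proj₂ : ∀ (q : Cell → Bool) (xs : List ℕ) ys → length ys ≤ length xs →
  allB (λ b → q (proj₂ b)) (zip xs ys) ≡ allB q ys
allB-zip-proj₂ q [] [] _ = refl
allB-zip-proj₂ q (x ∷ xs) [] _ = refl
allB-zip-proj₂ q (x ∷ xs) (y ∷ ys) (s≤s le) = cong (q y ∧_) (allB-zip-proj₂ q xs ys le)

respects : ℕ × Cell → ℕ × Cell → Bool
respects a b = not (rightOrBelow (proj₂ a) (proj₂ b)) ∨ (proj₁ a <ᵇ proj₁ b)

noneRightOrBelow : Cell → Filling → Bool
noneRightOrBelow c f = allB (λ d → not (rightOrBelow c d)) f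

-- The new entry is the largest one, so it only constrains the cells right of and below it.
increasing-∷ʳ : ∀ f c → increasing (f ∷ʳ c) ≡ increasing f ∧ noneRightOrBelow c f
increasing-∷ʳ f c = begin
    allPairs (zip (applyUpTo suc (length (f ∷ʳ c))) (f ∷ʳ c))
  ≡⟨ cong allPairs (zip-applyUpTo-∷ʳ suc f c) ⟩
    allPairs (I ++ [ z ])
  ≡⟨ allB-++ _ I [ z ] ⟩
    allB (λ a → allB (respects a) (I ++ [ z ])) I ∧ (allB (respects z) (I ++ [ z ]) ∧ true)
  ≡⟨ cong₂ _∧_ (allB-cong I old-pairs) (trans (∧-identityʳ _) new-pairs) ⟩
    increasing f ∧ noneRightOrBelow c f
  ∎
  where
    open ≡-Reasoning
    allPairs : List (ℕ × Cell) → Bool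
    allPairs J = allB (λ a → allB (respects a) J) J
    I = indexed f
    z : ℕ × Cell
    z = (suc (length f) , c)
    old-pairs : ∀ {a} → a ∈ I → allB (respects a) (I ++ [ z ]) ≡ allB (respects a) I
    old-pairs {a} a∈I = trans (allB-++ (respects a) I [ z ])
      (trans (cong (allB (respects a) I ∧_)
        (trans (∧-identityʳ _) (∨-introʳ {not (rightOrBelow (proj₂ a) c)}
                                  (<ᵇ-complete (s≤s (∈-indexed⇒≤length {f} a∈I))))))
      (∧-identityʳ _))
    respects-z : ∀ {b} → b ∈ I → respects z b ≡ not (rightOrBelow c (proj₂ b))
    respects-z {b} b∈I = trans (cong (not (rightOrBelow c (proj₂ b)) ∨_)
      (<ᵇ-false (m≤n⇒m≤1+n (∈-indexed⇒≤length {f} b∈I)))) (∨-identityʳ _)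
    new-pairs : allB (respects z) (I ++ [ z ]) ≡ noneRightOrBelow c f
    new-pairs = begin
        allB (respects z) (I ++ [ z ])
      ≡⟨ allB-++ (respects z) I [ z ] ⟩
        allB (respects z) I ∧ (respects z z ∧ true)
      ≡⟨ cong (λ b → allB (respects z) I ∧ ((not b ∨ (suc (length f) <ᵇ suc (length f))) ∧ true))
                (rightOrBelow-irrefl c) ⟩
        allB (respects z) I ∧ true
      ≡⟨ ∧-identityʳ _ ⟩
        allB (respects z) I
      ≡⟨ allB-cong I respects-z ⟩
        allB (λ b → not (rightOrBelow c (proj₂ b))) I
      ≡⟨ allB-zip-proj₂ (λ d → not (rightOrBelow c d)) (applyUpTo suc (length f)) f
           (≤-reflexive (sym (length-applyUpTo suc (length f)))) ⟩
        noneRightOrBelow c f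
      ∎

-- Removing the largest entry at a corner

isDouble : Filling → Cell → Bool
isDouble f d = mult f d ≡ᵇ 2

holdsOneOrTwo : Filling → Cell → Bool
holdsOneOrTwo f d = (mult f d ≡ᵇ 1) ∨ isDouble f d

doubleOnlyInColumn : ℕ → Filling → Cell → Bool
doubleOnlyInColumn k f d = not (isDouble f d) ∨ (col d ≡ᵇ k)

isSYT⇒∈ : ∀ {D f d} → isSYT D f ≡ true → d ∈ D → d ∈ f
isSYT⇒∈ {D} {f} h d∈D = mult≢0⇒∈ {f} (λ e →
  true≢false (trans (sym (allB-lookup {p = λ d → mult f d ≡ᵇ 1} (∧-elimˡ h) d∈D)) (cong (_≡ᵇ 1) e)))

isSBTcol⇒∈ : ∀ {k D f d} → isSBTcol k D f ≡ true → d ∈ D → d ∈ f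
isSBTcol⇒∈ {k} {D} {f} h d∈D = mult≢0⇒∈ {f} (λ e →
  true≢false (trans (sym (allB-lookup {p = holdsOneOrTwo f} (∧-elimˡ h) d∈D))
                    (cong (λ m → (m ≡ᵇ 1) ∨ (m ≡ᵇ 2)) e)))

isSYT⇒increasing : ∀ {D f} → isSYT D f ≡ true → increasing f ≡ true
isSYT⇒increasing {D} {f} = ∧-elimʳ {allB (λ d → mult f d ≡ᵇ 1) D}

isSBTcol⇒increasing : ∀ {k D f} → isSBTcol k D f ≡ true → increasing f ≡ true
isSBTcol⇒increasing {k} {D} {f} h =
  ∧-elimʳ {allB (doubleOnlyInColumn k f) D}
    (∧-elimʳ {countB (isDouble f) D ≡ᵇ 1} (∧-elimʳ {allB (holdsOneOrTwo f) D} h))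

-- The largest entry of an increasing filling cannot sit left of or above an occupied cell.
countLargestAt-blocked : ∀ (p : Filling → Bool) D N {c d} → rightOrBelow c d ≡ true →
  (∀ f → p f ≡ true → increasing f ≡ true × d ∈ f) → countLargestAt p D N c ≡ 0
countLargestAt-blocked p D N {c} {d} c↝d valid = countB-none (fillings D N) λ {f} _ → ¬-not λ pf →
  let inc , d∈ = valid (f ∷ʳ c) pf in
  [ (λ d∈f → true≢false (trans (sym (allB-lookup {p = λ e → not (rightOrBelow c e)}
                                        (∧-elimʳ {increasing f} (trans (sym (increasing-∷ʳ f c)) inc)) d∈f))
                                (cong not c↝d)))
  , (λ { (here refl) → true≢false (trans (sym c↝d) (rightOrBelow-irrefl c)) })
  ]′ (∈-++⁻ f d∈)

module Corner (A B : List Cell) (c : Cell) (c∉ : c ∉ A ++ B)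
              (corner : ∀ {d} → d ∈ A ++ c ∷ B → rightOrBelow c d ≡ false) where

  D D' : List Cell
  D = A ++ c ∷ B
  D' = A ++ B

  private
    c∈D : c ∈ D
    c∈D = ∈-++⁺ʳ A (here refl)

    c≢ : ∀ {d} → d ∈ D' → c ≢ d
    c≢ d∈ c≡d = c∉ (subst (_∈ D') (sym c≡d) d∈)

    increasing-∷ʳ-corner : ∀ f → (∀ {x} → x ∈ f → x ∈ D) → increasing (f ∷ʳ c) ≡ increasing f
    increasing-∷ʳ-corner f f⊆D = trans (increasing-∷ʳ f c)
      (trans (cong (increasing f ∧_) (allB-tabulate f (λ x∈f → cong not (corner (f⊆D x∈f)))))
             (∧-identityʳ _))

  isSYT-∷ʳ : ∀ f → (∀ {x} → x ∈ f → x ∈ D') → isSYT D (f ∷ʳ c) ≡ isSYT D' f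
  isSYT-∷ʳ f f⊆D' = cong₂ _∧_
    (trans (allB-++-∷ _ A B c single-c)
           (allB-cong D' (λ d∈ → cong (_≡ᵇ 1) (mult-∷ʳ-≢ f (c≢ d∈)))))
    (increasing-∷ʳ-corner f (∈-++-∷⁺ {A = A} ∘ f⊆D'))
    where
      single-c : (mult (f ∷ʳ c) c ≡ᵇ 1) ≡ true
      single-c rewrite mult-∷ʳ-≡ f c | ∉⇒mult≡0 {f} (c∉ ∘ f⊆D') = refl

  isSBTcol-∷ʳ-single : ∀ k f → (∀ {x} → x ∈ f → x ∈ D') →
    isSBTcol k D (f ∷ʳ c) ∧ (mult f c ≡ᵇ 0) ≡ isSBTcol k D' f
  isSBTcol-∷ʳ-single k f f⊆D' = begin
      isSBTcol k D f⁺ ∧ (mult f c ≡ᵇ 0)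
    ≡⟨ cong (λ m → isSBTcol k D f⁺ ∧ (m ≡ᵇ 0)) mult-f-c ⟩
      isSBTcol k D f⁺ ∧ true
    ≡⟨ ∧-identityʳ _ ⟩
      isSBTcol k D f⁺
    ≡⟨ cong₂ _∧_ sizes (cong₂ _∧_ doubles (cong₂ _∧_ columns
                   (increasing-∷ʳ-corner f (∈-++-∷⁺ {A = A} ∘ f⊆D')))) ⟩
      isSBTcol k D' f
    ∎
    where
      open ≡-Reasoning
      f⁺ : Filling
      f⁺ = f ∷ʳ c
      mult-f-c : mult f c ≡ 0
      mult-f-c = ∉⇒mult≡0 {f} (c∉ ∘ f⊆D')
      mult-c : mult f⁺ c ≡ 1
      mult-c rewrite mult-∷ʳ-≡ f c | mult-f-c = refl
      mult-d : ∀ {d} → d ∈ D' → mult f⁺ d ≡ mult f d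
      mult-d d∈ = mult-∷ʳ-≢ f (c≢ d∈)
      sizes : allB (holdsOneOrTwo f⁺) D ≡ allB (holdsOneOrTwo f) D'
      sizes = trans (allB-++-∷ (holdsOneOrTwo f⁺) A B c (cong (λ m → (m ≡ᵇ 1) ∨ (m ≡ᵇ 2)) mult-c))
                    (allB-cong D' (λ d∈ → cong (λ m → (m ≡ᵇ 1) ∨ (m ≡ᵇ 2)) (mult-d d∈)))
      doubles : (countB (isDouble f⁺) D ≡ᵇ 1) ≡ (countB (isDouble f) D' ≡ᵇ 1)
      doubles = cong (_≡ᵇ 1) (trans (countB-++-∷-false (isDouble f⁺) A B c (cong (_≡ᵇ 2) mult-c))
                                    (countB-cong D' (λ d∈ → cong (_≡ᵇ 2) (mult-d d∈))))
      columns : allB (doubleOnlyInColumn k f⁺) D ≡ allB (doubleOnlyInColumn k f) D'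
      columns = trans (allB-++-∷ (doubleOnlyInColumn k f⁺) A B c
                                 (cong (λ m → not (m ≡ᵇ 2) ∨ (col c ≡ᵇ k)) mult-c))
                      (allB-cong D' (λ {d} d∈ → cong (λ m → not (m ≡ᵇ 2) ∨ (col d ≡ᵇ k)) (mult-d d∈)))

  private
    double-at-c⇒ : ∀ k f → isSBTcol k D (f ∷ʳ c) ∧ not (mult f c ≡ᵇ 0) ≡ true →
                   (col c ≡ᵇ k) ∧ isSYT D f ≡ true
    double-at-c⇒ k f h = ∧-intro col≡k
      (∧-intro (allB-tabulate D single)
               (∧-elimˡ (trans (sym (increasing-∷ʳ f c)) (isSBTcol⇒increasing {k} {D} {f⁺} sbt))))
      where
        f⁺ : Filling
        f⁺ = f ∷ʳ c
        sbt = ∧-elimˡ h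
        all-oneOrTwo : allB (holdsOneOrTwo f⁺) D ≡ true
        all-oneOrTwo = ∧-elimˡ sbt
        one-double : (countB (isDouble f⁺) D ≡ᵇ 1) ≡ true
        one-double = ∧-elimˡ (∧-elimʳ {allB (holdsOneOrTwo f⁺) D} sbt)
        all-inColumn : allB (doubleOnlyInColumn k f⁺) D ≡ true
        all-inColumn =
          ∧-elimˡ (∧-elimʳ {countB (isDouble f⁺) D ≡ᵇ 1} (∧-elimʳ {allB (holdsOneOrTwo f⁺) D} sbt))
        c∈f : mult f c ≢ 0
        c∈f e = true≢false (trans (sym (∧-elimʳ {isSBTcol k D f⁺} h)) (cong (λ m → not (m ≡ᵇ 0)) e))
        mult-f-c : mult f c ≡ 1
        mult-f-c with mult f c in e | allB-lookup {p = holdsOneOrTwo f⁺} all-oneOrTwo c∈D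
        ... | zero | _ = ⊥-elim (c∈f e)
        ... | suc zero | _ = refl
        ... | suc (suc j) | u rewrite mult-∷ʳ-≡ f c | e = ⊥-elim (true≢false (sym u))
        double-c : mult f⁺ c ≡ 2
        double-c rewrite mult-∷ʳ-≡ f c | mult-f-c = refl
        no-other-double : countB (isDouble f⁺) D' ≡ 0
        no-other-double = suc-injective (trans (sym (countB-++-∷-true (isDouble f⁺) A B c (cong (_≡ᵇ 2) double-c)))
                                               (≡ᵇ-sound one-double))
        single : ∀ {d} → d ∈ D → (mult f d ≡ᵇ 1) ≡ true
        single {d} d∈ with ∈-++-∷⁻ {A = A} d∈
        ... | inj₁ refl rewrite mult-f-c = refl
        ... | inj₂ d∈D' with ∨-elim {mult f⁺ d ≡ᵇ 1} (allB-lookup {p = holdsOneOrTwo f⁺} all-oneOrTwo d∈)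
        ...   | inj₁ one = trans (cong (_≡ᵇ 1) (sym (mult-∷ʳ-≢ f (c≢ d∈D')))) one
        ...   | inj₂ two =
          ⊥-elim (true≢false (trans (sym two) (countB≡0⇒false {p = isDouble f⁺} no-other-double d∈D')))
        col≡k : (col c ≡ᵇ k) ≡ true
        col≡k = trans (sym (cong (λ m → not (m ≡ᵇ 2) ∨ (col c ≡ᵇ k)) double-c))
                      (allB-lookup {p = doubleOnlyInColumn k f⁺} all-inColumn c∈D)

    double-at-c⇐ : ∀ k f → (∀ {x} → x ∈ f → x ∈ D) → (col c ≡ᵇ k) ∧ isSYT D f ≡ true →
                   isSBTcol k D (f ∷ʳ c) ∧ not (mult f c ≡ᵇ 0) ≡ true
    double-at-c⇐ k f f⊆D h =
      ∧-intro (∧-intro (allB-tabulate D one-or-two)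
                       (∧-intro one-double (∧-intro (allB-tabulate D double-in-column) increasing-f⁺)))
              c∈f
      where
        f⁺ : Filling
        f⁺ = f ∷ʳ c
        col≡k = ∧-elimˡ h
        syt = ∧-elimʳ {col c ≡ᵇ k} h
        single : ∀ {d} → d ∈ D → mult f d ≡ 1
        single d∈ = ≡ᵇ-sound (allB-lookup {p = λ d → mult f d ≡ᵇ 1} (∧-elimˡ syt) d∈)
        double-c : mult f⁺ c ≡ 2
        double-c rewrite mult-∷ʳ-≡ f c | single c∈D = refl
        single-d : ∀ {d} → d ∈ D' → mult f⁺ d ≡ 1
        single-d d∈ = trans (mult-∷ʳ-≢ f (c≢ d∈)) (single (∈-++-∷⁺ {A = A} d∈))
        one-or-two : ∀ {d} → d ∈ D → holdsOneOrTwo f⁺ d ≡ true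
        one-or-two d∈ with ∈-++-∷⁻ {A = A} d∈
        ... | inj₁ refl rewrite double-c = refl
        ... | inj₂ d∈D' rewrite single-d d∈D' = refl
        double-in-column : ∀ {d} → d ∈ D → doubleOnlyInColumn k f⁺ d ≡ true
        double-in-column d∈ with ∈-++-∷⁻ {A = A} d∈
        ... | inj₁ refl rewrite double-c = col≡k
        ... | inj₂ d∈D' rewrite single-d d∈D' = refl
        one-double : (countB (isDouble f⁺) D ≡ᵇ 1) ≡ true
        one-double rewrite countB-++-∷-true (isDouble f⁺) A B c (cong (_≡ᵇ 2) double-c)
                         | countB-none {p = isDouble f⁺} D' (λ d∈ → cong (_≡ᵇ 2) (single-d d∈)) = refl
        increasing-f⁺ : increasing f⁺ ≡ true
        increasing-f⁺ = trans (increasing-∷ʳ-corner f f⊆D) (isSYT⇒increasing {D} {f} syt)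
        c∈f : not (mult f c ≡ᵇ 0) ≡ true
        c∈f rewrite single c∈D = refl

  isSBTcol-∷ʳ-double : ∀ k f → (∀ {x} → x ∈ f → x ∈ D) →
    isSBTcol k D (f ∷ʳ c) ∧ not (mult f c ≡ᵇ 0) ≡ (col c ≡ᵇ k) ∧ isSYT D f
  isSBTcol-∷ʳ-double k f f⊆D = ≡-fromTrue (double-at-c⇒ k f) (double-at-c⇐ k f f⊆D)

  countLargestAt-SYT : ∀ N → countLargestAt (isSYT D) D N c ≡ countB (isSYT D') (fillings D' N)
  countLargestAt-SYT N =
    trans (countB-fillings-avoiding _ A B c N c-single)
          (countB-cong (fillings D' N) (λ f∈ → isSYT-∷ʳ _ (fillings-⊆ N f∈)))
    where
      c-single : ∀ f → isSYT D (f ∷ʳ c) ≡ true → c ∉ f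
      c-single f h = mult≡0⇒∉ {f} (≡ᵇ-sound
        (trans (sym (cong (_≡ᵇ 1) (mult-∷ʳ-≡ f c)))
               (allB-lookup {p = λ e → mult (f ∷ʳ c) e ≡ᵇ 1} (∧-elimˡ h) c∈D)))

  countLargestAt-SBT : ∀ k N →
    countLargestAt (isSBTcol k D) D N c
      ≡ countB (isSBTcol k D') (fillings D' N) + ⟦ col c ≡ᵇ k ⟧ * countB (isSYT D) (fillings D N)
  countLargestAt-SBT k N =
    trans (countB-split _ (λ f → mult f c ≡ᵇ 0) (fillings D N))
      (cong₂ _+_
        (trans (countB-fillings-avoiding _ A B c N
                  (λ f h → mult≡0⇒∉ {f} (≡ᵇ-sound (∧-elimʳ {isSBTcol k D (f ∷ʳ c)} h))))
               (countB-cong (fillings D' N) (λ f∈ → isSBTcol-∷ʳ-single k _ (fillings-⊆ N f∈))))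
        (trans (countB-cong (fillings D N) (λ f∈ → isSBTcol-∷ʳ-double k _ (fillings-⊆ N f∈)))
               (countB-const∧ (col c ≡ᵇ k) (isSYT D) (fillings D N))))

-- Shifted diagrams and their corners

-- λᵢ for 1 ≤ i ≤ n, and 0 for every other i.
part : List ℕ → ℕ → ℕ
part [] _ = 0
part (l ∷ ls) zero = 0
part (l ∷ ls) (suc zero) = l
part (l ∷ ls) (suc (suc i)) = part ls (suc i)

∑rows : ℕ → (ℕ → ℕ) → ℕ
∑rows zero f = 0
∑rows (suc n) f = f 1 + ∑rows n (λ j → f (suc j))

∑rows-cong : ∀ n {f h : ℕ → ℕ} → (∀ j → j < n → f (suc j) ≡ h (suc j)) → ∑rows n f ≡ ∑rows n h
∑rows-cong zero e = refl
∑rows-cong (suc n) e = cong₂ _+_ (e 0 (s≤s z≤n)) (∑rows-cong n (λ j j<n → e (suc j) (s≤s j<n)))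

∑rows-zero : ∀ n {f : ℕ → ℕ} → (∀ j → j < n → f (suc j) ≡ 0) → ∑rows n f ≡ 0
∑rows-zero zero _ = refl
∑rows-zero (suc n) e = cong₂ _+_ (e 0 (s≤s z≤n)) (∑rows-zero n (λ j j<n → e (suc j) (s≤s j<n)))

∑rows-+ : ∀ n (f h : ℕ → ℕ) → ∑rows n (λ j → f j + h j) ≡ ∑rows n f + ∑rows n h
∑rows-+ zero f h = refl
∑rows-+ (suc n) f h = trans (cong (f 1 + h 1 +_) (∑rows-+ n (λ j → f (suc j)) (λ j → h (suc j))))
                            (interchange (f 1) (h 1) _ _)

∑rows-*ˡ : ∀ n c (f : ℕ → ℕ) → ∑rows n (λ j → c * f j) ≡ c * ∑rows n f
∑rows-*ˡ zero c f = sym (*-zeroʳ c)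
∑rows-*ˡ (suc n) c f = trans (cong (c * f 1 +_) (∑rows-*ˡ n c (λ j → f (suc j)))) (sym (*-distribˡ-+ c (f 1) _))

∑rows-*ʳ : ∀ n (f : ℕ → ℕ) c → ∑rows n (λ j → f j * c) ≡ ∑rows n f * c
∑rows-*ʳ n f c =
  trans (∑rows-cong n (λ j _ → *-comm (f (suc j)) c)) (trans (∑rows-*ˡ n c f) (*-comm c (∑rows n f)))

∑rows-comm : ∀ n m (h : ℕ → ℕ → ℕ) →
  ∑rows n (λ i → ∑rows m (h i)) ≡ ∑rows m (λ r → ∑rows n (λ i → h i r))
∑rows-comm zero m h = sym (∑rows-zero m (λ _ _ → refl))
∑rows-comm (suc n) m h = trans (cong (∑rows m (h 1) +_) (∑rows-comm n m (λ i → h (suc i))))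
                               (sym (∑rows-+ m (h 1) (λ r → ∑rows n (λ i → h (suc i) r))))

∑rows-diagonal : ∀ n (f : ℕ → ℕ) →
  ∑rows n (λ i → ∑rows n (λ r → ⟦ i ≡ᵇ r ⟧ * f r)) ≡ ∑rows n f
∑rows-diagonal n f = ∑rows-cong n (λ i i<n → ∑rows-single n f i i<n)
  where
    ∑rows-single : ∀ n (f : ℕ → ℕ) i → i < n → ∑rows n (λ r → ⟦ suc i ≡ᵇ r ⟧ * f r) ≡ f (suc i)
    ∑rows-single (suc n) f zero _ =
      trans (cong₂ _+_ (+-identityʳ (f 1)) (∑rows-zero n (λ _ _ → refl))) (+-identityʳ _)
    ∑rows-single (suc n) f (suc i) (s≤s i<n) = ∑rows-single n (λ r → f (suc r)) i i<n

infix 4 _≻_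
_≻_ : ℕ → ℕ → Set
a ≻ b = b < a ⊎ b ≡ 0

-- Strictly decreasing parts followed by zero parts: removing the cell of a row
-- of length one leaves a zero part behind.
IsStrictShape : List ℕ → Set
IsStrictShape L = ∀ j → part L (suc j) ≻ part L (suc (suc j))

IsStrictPartition⇒IsStrictShape : ∀ {L} → IsStrictPartition L → IsStrictShape L
IsStrictPartition⇒IsStrictShape (_ , decreasing) = go decreasing
  where
    go : ∀ {L} → Linked _>_ L → IsStrictShape L
    go [] j = inj₂ refl
    go [-] zero = inj₂ refl
    go [-] (suc j) = inj₂ refl
    go (l>l' ∷ _) zero = inj₁ l>l'
    go (_ ∷ rest) (suc j) = go rest j

rowCells : ℕ → ℕ → List Cell
rowCells i l = applyUpTo (λ t → (i , i + t)) l

lastCell : ℕ → ℕ → Cell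
lastCell i l = (i , i + (l ∸ 1))

-- In a shifted diagram the cell below the last cell of a row of length l exists
-- iff the next row has length at least l − 1.
cornerᵇ : ℕ → ℕ → Bool
cornerᵇ l next = (1 ≤ᵇ l) ∧ ((next ≡ᵇ 0) ∨ (next + 2 ≤ᵇ l))

hasCorner : List ℕ → ℕ → Bool
hasCorner L r = cornerᵇ (part L r) (part L (suc r))

cornerᵇ⇒nonEmpty : ∀ l next → cornerᵇ l next ≡ true → 1 ≤ l
cornerᵇ⇒nonEmpty l next h = ≤ᵇ-sound (∧-elimˡ h)

¬cornerᵇ⇒below : ∀ m next → suc m ≻ next → cornerᵇ (suc m) next ≡ false →
  ∃ λ t → next ≡ suc t × m ≡ suc t
¬cornerᵇ⇒below m zero _ ()
¬cornerᵇ⇒below m (suc t) (inj₂ ())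
¬cornerᵇ⇒below m (suc t) (inj₁ t<m) ¬corner with m ≟ suc t
... | yes m≡ = t , refl , m≡
... | no m≢ = ⊥-elim (true≢false (trans (sym (≤ᵇ-complete far)) ¬corner))
  where
    far : suc t + 2 ≤ suc m
    far = subst (_≤ suc m) (+-comm 2 (suc t)) (s≤s (≤∧≢⇒< (≤-pred t<m) (m≢ ∘ sym)))

row≥ : ∀ {i L d} → d ∈ shiftedFrom i L → i ≤ row d
row≥ {i} {l ∷ L} d∈ with ∈-++⁻ (rowCells i l) d∈
... | inj₁ d∈row with ∈-applyUpTo⁻ (λ t → (i , i + t)) d∈row
...   | t , _ , refl = ≤-refl
row≥ {i} {l ∷ L} d∈ | inj₂ d∈rest = ≤-trans (n≤1+n i) (row≥ {suc i} {L} d∈rest)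

∈-shiftedFrom⁻ : ∀ {i L d} → d ∈ shiftedFrom i L →
  (row d ≡ i × ∃ λ t → t < part L 1 × col d ≡ i + t) ⊎ suc i ≤ row d
∈-shiftedFrom⁻ {i} {l ∷ L} d∈ with ∈-++⁻ (rowCells i l) d∈
... | inj₁ d∈row with ∈-applyUpTo⁻ (λ t → (i , i + t)) d∈row
...   | t , t<l , refl = inj₁ (refl , t , t<l , refl)
∈-shiftedFrom⁻ {i} {l ∷ L} d∈ | inj₂ d∈rest = inj₂ (row≥ {suc i} {L} d∈rest)

∈-shiftedFrom⁺ : ∀ i L {t} → t < part L 1 → (i , i + t) ∈ shiftedFrom i L
∈-shiftedFrom⁺ i [] t<0 = ⊥-elim (n≮0 t<0)
∈-shiftedFrom⁺ i (l ∷ L) t<l = ∈-++⁺ˡ (∈-applyUpTo⁺ (λ t → (i , i + t)) t<l)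

VanishesOffCorners : (Cell → ℕ) → List Cell → Set
VanishesOffCorners Q D = ∀ {c d} → d ∈ D → rightOrBelow c d ≡ true → Q c ≡ 0

module _ (Q : Cell → ℕ) where

  ∑-rowCells : ∀ i m next rest → VanishesOffCorners Q (rowCells i (suc m) ++ rest) → suc m ≻ next →
    (∀ {t} → t < next → (suc i , suc i + t) ∈ rest) →
    ∑ (rowCells i (suc m)) Q ≡ ⟦ cornerᵇ (suc m) next ⟧ * Q (lastCell i (suc m))
  ∑-rowCells i m next rest vanish m≻next below∈rest = begin
      ∑ (rowCells i (suc m)) Q
    ≡⟨ cong (λ cs → ∑ cs Q) (sym (applyUpTo-∷ʳ (λ t → (i , i + t)) m)) ⟩
      ∑ (rowCells i m ∷ʳ (i , i + m)) Q
    ≡⟨ ∑-++ Q (rowCells i m) [ (i , i + m) ] ⟩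
      ∑ (rowCells i m) Q + (Q (i , i + m) + 0)
    ≡⟨ cong₂ _+_ (trans (∑-cong (rowCells i m) inner-vanish) (∑-zero (rowCells i m))) (+-identityʳ _) ⟩
      Q (i , i + m)
    ≡⟨ last ⟩
      ⟦ cornerᵇ (suc m) next ⟧ * Q (lastCell i (suc m))
    ∎
    where
      open ≡-Reasoning
      inner-vanish : ∀ {x} → x ∈ rowCells i m → Q x ≡ 0
      inner-vanish x∈ with ∈-applyUpTo⁻ (λ t → (i , i + t)) x∈
      ... | t , t<m , refl = vanish (∈-++⁺ˡ (∈-applyUpTo⁺ (λ t → (i , i + t)) {i = suc t} (s≤s t<m)))
            (subst (λ j → rightOrBelow (i , i + t) (i , j) ≡ true) (sym (+-suc i t)) (rightOrBelow-right i (i + t)))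
      last : Q (i , i + m) ≡ ⟦ cornerᵇ (suc m) next ⟧ * Q (lastCell i (suc m))
      last with cornerᵇ (suc m) next in corner
      ... | true = sym (+-identityʳ _)
      ... | false with ¬cornerᵇ⇒below m next m≻next corner
      ...   | t , refl , refl = vanish (∈-++⁺ʳ (rowCells i (suc (suc t))) (below∈rest (n<1+n t)))
              (subst (λ j → rightOrBelow (i , i + suc t) (suc i , j) ≡ true) (+-suc i t)
                     (rightOrBelow-below i (i + suc t)))

  ∑-shiftedFrom : ∀ s L → IsStrictShape L → VanishesOffCorners Q (shiftedFrom (suc s) L) →
    ∑ (shiftedFrom (suc s) L) Q ≡ ∑rows (length L) (λ j → ⟦ hasCorner L j ⟧ * Q (lastCell (j + s) (part L j)))
  ∑-shiftedFrom s [] shape vanish = refl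
  ∑-shiftedFrom s (l ∷ ls) shape vanish =
    trans (∑-++ Q (rowCells (suc s) l) (shiftedFrom (suc (suc s)) ls))
      (cong₂ _+_ (first-row l (shape 0) vanish)
        (trans (∑-shiftedFrom (suc s) ls (shape ∘ suc) (vanish ∘ ∈-++⁺ʳ (rowCells (suc s) l)))
               (∑rows-cong (length ls) (λ j _ →
                  cong (λ r → ⟦ hasCorner ls (suc j) ⟧ * Q (lastCell r (part ls (suc j)))) (+-suc (suc j) s)))))
    where
      first-row : ∀ l → l ≻ part ls 1 → VanishesOffCorners Q (shiftedFrom (suc s) (l ∷ ls)) →
                  ∑ (rowCells (suc s) l) Q ≡ ⟦ cornerᵇ l (part ls 1) ⟧ * Q (lastCell (suc s) l)
      first-row zero _ _ = refl
      first-row (suc m) l≻ vanish =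
        ∑-rowCells (suc s) m (part ls 1) (shiftedFrom (suc (suc s)) ls) vanish l≻ (∈-shiftedFrom⁺ (suc (suc s)) ls)

decPart : ℕ → List ℕ → List ℕ
decPart i [] = []
decPart zero (l ∷ ls) = l ∷ ls
decPart (suc zero) (l ∷ ls) = pred l ∷ ls
decPart (suc (suc i)) (l ∷ ls) = l ∷ decPart (suc i) ls

record CornerSplit (D D' : List Cell) (c : Cell) : Set where
  field
    before after : List Cell
    D≡ : D ≡ before ++ c ∷ after
    D'≡ : D' ≡ before ++ after
    c∉ : c ∉ before ++ after
    isCorner : ∀ {d} → d ∈ before ++ c ∷ after → rightOrBelow c d ≡ false

cornerSplit : ∀ s L r i → suc r + s ≡ i → hasCorner L (suc r) ≡ true →
  CornerSplit (shiftedFrom (suc s) L) (shiftedFrom (suc s) (decPart (suc r) L)) (lastCell i (part L (suc r)))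
cornerSplit s [] zero i _ ()
cornerSplit s (zero ∷ ls) zero i _ ()
cornerSplit s (suc m ∷ ls) zero .(suc s) refl corner = record
  { before = A ; after = B ; D≡ = D≡ ; D'≡ = refl ; c∉ = c∉ ; isCorner = isCorner }
  where
    c : Cell
    c = (suc s , suc s + m)
    A = rowCells (suc s) m
    B = shiftedFrom (suc (suc s)) ls
    D≡ : shiftedFrom (suc s) (suc m ∷ ls) ≡ A ++ c ∷ B
    D≡ = trans (cong (_++ B) (sym (applyUpTo-∷ʳ (λ t → (suc s , suc s + t)) m))) (++-assoc A [ c ] B)
    c∉ : c ∉ A ++ B
    c∉ c∈ with ∈-++⁻ A c∈
    ... | inj₁ c∈A with ∈-applyUpTo⁻ (λ t → (suc s , suc s + t)) c∈A
    ...   | t , t<m , c≡ = <-irrefl (sym (+-cancelˡ-≡ (suc s) m t (cong col c≡))) t<m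
    c∉ c∈ | inj₂ c∈B = 1+n≰n (row≥ {suc (suc s)} {ls} c∈B)
    nothing-right : ∀ {d} → d ∈ A ++ B → d ≢ (suc s , suc (suc s + m))
    nothing-right d∈ refl with ∈-++⁻ A d∈
    ... | inj₂ d∈B = 1+n≰n (row≥ {suc (suc s)} {ls} d∈B)
    ... | inj₁ d∈A with ∈-applyUpTo⁻ (λ t → (suc s , suc s + t)) d∈A
    ...   | t , t<m , d≡ = <-asym t<m (≤-reflexive (+-cancelˡ-≡ (suc s) (suc m) t
                                                        (trans (+-suc (suc s) m) (cong col d≡))))
    nothing-below : ∀ {d} → d ∈ A ++ B → d ≢ (suc (suc s) , suc s + m)
    nothing-below d∈ refl with ∈-++⁻ A d∈
    ... | inj₁ d∈A with ∈-applyUpTo⁻ (λ t → (suc s , suc s + t)) d∈A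
    ...   | t , _ , d≡ = 1+n≢n (cong row d≡)
    nothing-below d∈ refl | inj₂ d∈B with ∈-shiftedFrom⁻ {suc (suc s)} {ls} d∈B
    ... | inj₂ le = 1+n≰n le
    ... | inj₁ (_ , t , t<next , col≡) =
          below-excluded (+-cancelˡ-≡ (suc s) m (suc t) (trans col≡ (sym (+-suc (suc s) t))))
      where
        below-excluded : m ≢ suc t
        below-excluded refl with ∨-elim {part ls 1 ≡ᵇ 0} (∧-elimʳ {1 ≤ᵇ suc (suc t)} corner)
        ... | inj₁ empty = n≮0 (subst (t <_) (≡ᵇ-sound empty) t<next)
        ... | inj₂ far = <-irrefl refl (≤-trans t<next (≤-pred (≤-pred
                           (≤-trans (≤-reflexive (+-comm 2 (part ls 1))) (≤ᵇ-sound far)))))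
    isCorner : ∀ {d} → d ∈ A ++ c ∷ B → rightOrBelow c d ≡ false
    isCorner {d} d∈ = ¬-not λ c↝d → excluded (∈-++-∷⁻ {A = A} d∈) (rightOrBelow-sound c d c↝d)
      where
        excluded : d ≡ c ⊎ d ∈ A ++ B → d ≡ (suc s , suc (suc s + m)) ⊎ d ≡ (suc (suc s) , suc s + m) → ⊥
        excluded (inj₁ refl) (inj₁ d≡) = 1+n≢n (sym (cong col d≡))
        excluded (inj₁ refl) (inj₂ d≡) = 1+n≢n (sym (cong row d≡))
        excluded (inj₂ d∈) (inj₁ d≡) = nothing-right d∈ d≡
        excluded (inj₂ d∈) (inj₂ d≡) = nothing-below d∈ d≡
cornerSplit s [] (suc r) i _ ()
cornerSplit s (l ∷ ls) (suc r) i i≡ corner = record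
  { before = R ++ before ; after = after
  ; D≡ = trans (cong (R ++_) D≡) (sym (++-assoc R before (c ∷ after)))
  ; D'≡ = trans (cong (R ++_) D'≡) (sym (++-assoc R before after))
  ; c∉ = c∉′ ; isCorner = isCorner′ }
  where
    open CornerSplit (cornerSplit (suc s) ls r i (trans (+-suc (suc r) s) i≡) corner)
    R = rowCells (suc s) l
    c = lastCell i (part ls (suc r))
    row-c : suc (suc s) ≤ i
    row-c = subst (suc (suc s) ≤_) i≡ (s≤s (s≤s (m≤n+m s r)))
    row-R : ∀ {d} → d ∈ R → row d ≡ suc s
    row-R d∈ with ∈-applyUpTo⁻ (λ t → (suc s , suc s + t)) d∈
    ... | t , _ , refl = refl
    c∉′ : c ∉ (R ++ before) ++ after
    c∉′ c∈ with ∈-++⁻ R (subst (c ∈_) (++-assoc R before after) c∈)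
    ... | inj₁ c∈R = 1+n≰n (subst (suc (suc s) ≤_) (row-R c∈R) row-c)
    ... | inj₂ c∈′ = c∉ c∈′
    isCorner′ : ∀ {d} → d ∈ (R ++ before) ++ c ∷ after → rightOrBelow c d ≡ false
    isCorner′ {d} d∈ with ∈-++⁻ R (subst (d ∈_) (++-assoc R before (c ∷ after)) d∈)
    ... | inj₂ d∈′ = isCorner d∈′
    ... | inj₁ d∈R = ¬-not λ c↝d →
      [ (λ d≡ → 1+n≰n (subst (suc (suc s) ≤_) (trans (sym (cong row d≡)) (row-R d∈R)) row-c))
                                   , (λ d≡ → 1+n≰n (≤-trans (s≤s (≤-trans (n≤1+n (suc s)) row-c))
                                                              (≤-reflexive (trans (sym (cong row d≡)) (row-R d∈R)))))
                                   ]′ (rightOrBelow-sound c d c↝d)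

-- Corner recursions for g and g⁺ₖ

sum-decPart : ∀ L r → 1 ≤ part L (suc r) → suc (sum (decPart (suc r) L)) ≡ sum L
sum-decPart (suc l ∷ ls) zero _ = refl
sum-decPart (l ∷ ls) (suc r) nonEmpty = trans (sym (+-suc l _)) (cong (l +_) (sum-decPart ls r nonEmpty))

length-decPart : ∀ L r → length (decPart r L) ≡ length L
length-decPart [] r = refl
length-decPart (l ∷ ls) zero = refl
length-decPart (l ∷ ls) (suc zero) = refl
length-decPart (l ∷ ls) (suc (suc r)) = cong suc (length-decPart ls (suc r))

hasCorner⇒nonEmpty : ∀ L r → hasCorner L r ≡ true → 1 ≤ part L r
hasCorner⇒nonEmpty L r = cornerᵇ⇒nonEmpty (part L r) (part L (suc r))

g-corners : ∀ L M → sum L ≡ suc M → IsStrictShape L →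
  g L ≡ ∑rows (length L) (λ r → ⟦ hasCorner L r ⟧ * g (decPart r L))
g-corners L M |L|≡ shape =
  trans (cong (λ N → countB (isSYT D) (fillings D N)) |L|≡)
  (trans (countB-fillings-∷ʳ (isSYT D) D M)
  (trans (∑-shiftedFrom (countLargestAt (isSYT D) D M) 0 L shape
            (λ d∈ c↝d → countLargestAt-blocked (isSYT D) D M c↝d
                          (λ f syt → isSYT⇒increasing {D} {f} syt , isSYT⇒∈ syt d∈)))
         (∑rows-cong (length L) at-row)))
  where
    D = shiftedDiagram L
    at-row : ∀ j → j < length L →
      ⟦ hasCorner L (suc j) ⟧ * countLargestAt (isSYT D) D M (lastCell (suc j + 0) (part L (suc j)))
        ≡ ⟦ hasCorner L (suc j) ⟧ * g (decPart (suc j) L)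
    at-row j _ with hasCorner L (suc j) in corner
    ... | false = refl
    ... | true = cong (1 *_) (begin
        countLargestAt (isSYT D) D M c
      ≡⟨ cong (λ E → countLargestAt (isSYT E) E M c) D≡ ⟩
        countLargestAt (isSYT (before ++ c ∷ after)) (before ++ c ∷ after) M c
      ≡⟨ Corner.countLargestAt-SYT before after c c∉ isCorner M ⟩
        countB (isSYT (before ++ after)) (fillings (before ++ after) M)
      ≡⟨ sym (cong₂ (λ E N → countB (isSYT E) (fillings E N)) D'≡
                    (suc-injective (trans (sum-decPart L j (hasCorner⇒nonEmpty L (suc j) corner)) |L|≡))) ⟩
        g (decPart (suc j) L)
      ∎)
      where
        open ≡-Reasoning
        c = lastCell (suc j + 0) (part L (suc j))
        open CornerSplit (cornerSplit 0 L j (suc j + 0) refl corner)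

gPlus-corners : ∀ L k → IsStrictShape L →
  gPlus L k ≡ ∑rows (length L) (λ r →
    ⟦ hasCorner L r ⟧ * (gPlus (decPart r L) k + ⟦ (r + (part L r ∸ 1)) ≡ᵇ k ⟧ * g L))
gPlus-corners L k shape =
  trans (countB-fillings-∷ʳ (isSBTcol k D) D (sum L))
  (trans (∑-shiftedFrom (countLargestAt (isSBTcol k D) D (sum L)) 0 L shape
            (λ d∈ c↝d → countLargestAt-blocked (isSBTcol k D) D (sum L) c↝d
                          (λ f sbt → isSBTcol⇒increasing {k} {D} {f} sbt , isSBTcol⇒∈ {k} sbt d∈)))
         (∑rows-cong (length L) at-row))
  where
    D = shiftedDiagram L
    at-row : ∀ j → j < length L →
      ⟦ hasCorner L (suc j) ⟧ * countLargestAt (isSBTcol k D) D (sum L) (lastCell (suc j + 0) (part L (suc j)))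
        ≡ ⟦ hasCorner L (suc j) ⟧
          * (gPlus (decPart (suc j) L) k + ⟦ (suc j + (part L (suc j) ∸ 1)) ≡ᵇ k ⟧ * g L)
    at-row j _ with hasCorner L (suc j) in corner
    ... | false = refl
    ... | true = cong (1 *_) (begin
        countLargestAt (isSBTcol k D) D (sum L) c
      ≡⟨ cong (λ E → countLargestAt (isSBTcol k E) E (sum L) c) D≡ ⟩
        countLargestAt (isSBTcol k (before ++ c ∷ after)) (before ++ c ∷ after) (sum L) c
      ≡⟨ Corner.countLargestAt-SBT before after c c∉ isCorner k (sum L) ⟩
        countB (isSBTcol k (before ++ after)) (fillings (before ++ after) (sum L))
          + ⟦ col c ≡ᵇ k ⟧ * countB (isSYT (before ++ c ∷ after)) (fillings (before ++ c ∷ after) (sum L))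
      ≡⟨ cong₂ _+_ (sym (cong₂ (λ E N → countB (isSBTcol k E) (fillings E N)) D'≡
                                (sum-decPart L j (hasCorner⇒nonEmpty L (suc j) corner))))
                   (cong₂ (λ a E → ⟦ a ≡ᵇ k ⟧ * countB (isSYT E) (fillings E (sum L)))
                          (cong (_+ (part L (suc j) ∸ 1)) (+-identityʳ (suc j))) (sym D≡)) ⟩
        gPlus (decPart (suc j) L) k + ⟦ (suc j + (part L (suc j) ∸ 1)) ≡ᵇ k ⟧ * g L
      ∎)
      where
        open ≡-Reasoning
        c = lastCell (suc j + 0) (part L (suc j))
        open CornerSplit (cornerSplit 0 L j (suc j + 0) refl corner)

-- Northeast cells

isNE : List ℕ → ℕ → Bool
isNE L i = (i ≡ᵇ 1) ∨ (part L i + 2 ≤ᵇ part L (pred i))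

∑-filter : ∀ k (h : Cell → ℕ) xs →
  sum (map h (filter (λ c → k <? col c) xs)) ≡ ∑ xs (λ c → ⟦ k <ᵇ col c ⟧ * h c)
∑-filter k h [] = refl
∑-filter k h (x ∷ xs) with k <? col x
... | yes k<x rewrite <ᵇ-complete k<x = cong₂ _+_ (sym (+-identityʳ (h x))) (∑-filter k h xs)
... | no k≮x rewrite ¬-not {k <ᵇ col x} (k≮x ∘ <ᵇ-sound) = ∑-filter k h xs

∑-neFrom : ∀ k (h : Cell → ℕ) s prev L →
  ∑ (neFrom (suc s) prev L) (λ c → ⟦ k <ᵇ col c ⟧ * h c) ≡
  ∑rows (length L) (λ j →
    ⟦ (part L j + 2 ≤ᵇ part (prev ∷ L) j) ∧ (k <ᵇ (j + s) + part L j) ⟧ * h (j + s , (j + s) + part L j))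
∑-neFrom k h s prev [] = refl
∑-neFrom k h s prev (l ∷ ls) =
  trans (∑-++ F (if l + 2 ≤ᵇ prev then (suc s , suc s + l) ∷ [] else []) (neFrom (suc (suc s)) l ls))
    (cong₂ _+_ first-row
      (trans (∑-neFrom k h (suc s) l ls)
        (∑rows-cong (length ls) (λ j _ →
          cong (λ r → ⟦ (part ls (suc j) + 2 ≤ᵇ part (l ∷ ls) (suc j)) ∧ (k <ᵇ r + part ls (suc j)) ⟧
                      * h (r , r + part ls (suc j)))
               (+-suc (suc j) s)))))
  where
    F : Cell → ℕ
    F c = ⟦ k <ᵇ col c ⟧ * h c
    first-row : ∑ (if l + 2 ≤ᵇ prev then (suc s , suc s + l) ∷ [] else []) F ≡
                ⟦ (l + 2 ≤ᵇ prev) ∧ (k <ᵇ suc s + l) ⟧ * h (suc s , suc s + l)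
    first-row with l + 2 ≤ᵇ prev
    ... | true = +-identityʳ _
    ... | false = refl

neSum-rows : ∀ L k →
  neSum L k ≡ ∑rows (length L) (λ i → ⟦ isNE L i ∧ (k <ᵇ i + part L i) ⟧ * g (incPart i L))
neSum-rows [] k = refl
neSum-rows (l ∷ ls) k =
  trans (∑-filter k h (NE (l ∷ ls)))
    (cong (⟦ k <ᵇ 1 + l ⟧ * h (1 , 1 + l) +_)
      (trans (∑-neFrom k h 1 l ls)
        (∑rows-cong (length ls) (λ j _ →
          cong (λ i → ⟦ (part ls (suc j) + 2 ≤ᵇ part (l ∷ ls) (suc j)) ∧ (k <ᵇ i + part ls (suc j)) ⟧
                      * g (incPart i (l ∷ ls)))
               (+-comm (suc j) 1)))))
  where
    h : Cell → ℕ
    h c = g (addCell (l ∷ ls) c)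

part-incPart-≢ : ∀ L i j → i ≢ j → part (incPart i L) j ≡ part L j
part-incPart-≢ [] i j i≢j = refl
part-incPart-≢ (l ∷ ls) zero j i≢j = refl
part-incPart-≢ (l ∷ ls) (suc zero) zero i≢j = refl
part-incPart-≢ (l ∷ ls) (suc zero) (suc zero) i≢j = ⊥-elim (i≢j refl)
part-incPart-≢ (l ∷ ls) (suc zero) (suc (suc j)) i≢j = refl
part-incPart-≢ (l ∷ ls) (suc (suc i)) zero i≢j = refl
part-incPart-≢ (l ∷ ls) (suc (suc i)) (suc zero) i≢j = refl
part-incPart-≢ (l ∷ ls) (suc (suc i)) (suc (suc j)) i≢j =
  part-incPart-≢ ls (suc i) (suc j) (λ e → i≢j (cong suc e))

part-incPart-≡ : ∀ L i → i < length L → part (incPart (suc i) L) (suc i) ≡ suc (part L (suc i))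
part-incPart-≡ (l ∷ ls) zero _ = refl
part-incPart-≡ (l ∷ ls) (suc i) (s≤s i<n) = part-incPart-≡ ls i i<n

part-decPart-≢ : ∀ L i j → i ≢ j → part (decPart i L) j ≡ part L j
part-decPart-≢ [] i j i≢j = refl
part-decPart-≢ (l ∷ ls) zero j i≢j = refl
part-decPart-≢ (l ∷ ls) (suc zero) zero i≢j = refl
part-decPart-≢ (l ∷ ls) (suc zero) (suc zero) i≢j = ⊥-elim (i≢j refl)
part-decPart-≢ (l ∷ ls) (suc zero) (suc (suc j)) i≢j = refl
part-decPart-≢ (l ∷ ls) (suc (suc i)) zero i≢j = refl
part-decPart-≢ (l ∷ ls) (suc (suc i)) (suc zero) i≢j = refl
part-decPart-≢ (l ∷ ls) (suc (suc i)) (suc (suc j)) i≢j =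
  part-decPart-≢ ls (suc i) (suc j) (λ e → i≢j (cong suc e))

part-decPart-≡ : ∀ L i → part (decPart i L) i ≡ part L i ∸ 1
part-decPart-≡ [] i = refl
part-decPart-≡ (l ∷ ls) zero = refl
part-decPart-≡ (zero ∷ ls) (suc zero) = refl
part-decPart-≡ (suc l ∷ ls) (suc zero) = refl
part-decPart-≡ (l ∷ ls) (suc (suc i)) = part-decPart-≡ ls (suc i)

decPart-incPart : ∀ L i → decPart i (incPart i L) ≡ L
decPart-incPart [] i = refl
decPart-incPart (l ∷ ls) zero = refl
decPart-incPart (l ∷ ls) (suc zero) = refl
decPart-incPart (l ∷ ls) (suc (suc i)) = cong (l ∷_) (decPart-incPart ls (suc i))

incPart-decPart : ∀ L i → 1 ≤ part L i → incPart i (decPart i L) ≡ L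
incPart-decPart (suc l ∷ ls) (suc zero) _ = refl
incPart-decPart (l ∷ ls) (suc (suc i)) nonEmpty = cong (l ∷_) (incPart-decPart ls (suc i) nonEmpty)

incPart-decPart-comm : ∀ L i j → i ≢ j → incPart (suc i) (decPart (suc j) L) ≡ decPart (suc j) (incPart (suc i) L)
incPart-decPart-comm [] i j i≢j = refl
incPart-decPart-comm (l ∷ ls) zero zero i≢j = ⊥-elim (i≢j refl)
incPart-decPart-comm (l ∷ ls) zero (suc j) i≢j = refl
incPart-decPart-comm (l ∷ ls) (suc i) zero i≢j = refl
incPart-decPart-comm (l ∷ ls) (suc i) (suc j) i≢j =
  cong (l ∷_) (incPart-decPart-comm ls i j (λ e → i≢j (cong suc e)))

sum-incPart : ∀ L i → i < length L → sum (incPart (suc i) L) ≡ suc (sum L)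
sum-incPart (l ∷ ls) zero _ = refl
sum-incPart (l ∷ ls) (suc i) (s≤s i<n) = trans (cong (l +_) (sum-incPart ls i i<n)) (+-suc l _)

length-incPart : ∀ L i → length (incPart i L) ≡ length L
length-incPart [] i = refl
length-incPart (l ∷ ls) zero = refl
length-incPart (l ∷ ls) (suc zero) = refl
length-incPart (l ∷ ls) (suc (suc i)) = cong suc (length-incPart ls (suc i))

≻-cong : ∀ {a a' b b'} → a ≡ a' → b ≡ b' → a ≻ b → a' ≻ b'
≻-cong refl refl a≻b = a≻b

IsStrictShape-incPart : ∀ L i → IsStrictShape L → i < length L → isNE L (suc i) ≡ true →
  IsStrictShape (incPart (suc i) L)
IsStrictShape-incPart L i shape i<n ne j with j ≟ i
... | yes refl =
  ≻-cong (sym (part-incPart-≡ L i i<n)) (sym (part-incPart-≢ L (suc i) (suc (suc i)) (1+n≢n ∘ sym)))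
                        (grow (shape i))
  where
    grow : ∀ {a b} → a ≻ b → suc a ≻ b
    grow (inj₁ b<a) = inj₁ (m≤n⇒m≤1+n b<a)
    grow (inj₂ b≡0) = inj₂ b≡0
... | no j≢i with suc j ≟ i
...   | yes refl = ≻-cong (sym (part-incPart-≢ L (suc (suc j)) (suc j) 1+n≢n)) (sym (part-incPart-≡ L (suc j) i<n))
                          (inj₁ (≤-trans (≤-reflexive (+-comm 2 (part L (suc (suc j))))) (≤ᵇ-sound ne)))
...   | no sj≢i = ≻-cong (sym (part-incPart-≢ L (suc i) (suc j) (j≢i ∘ sym ∘ suc-injective)))
                         (sym (part-incPart-≢ L (suc i) (suc (suc j)) (sj≢i ∘ sym ∘ suc-injective)))
                         (shape j)

IsStrictShape-decPart : ∀ L r → IsStrictShape L → hasCorner L r ≡ true → IsStrictShape (decPart r L)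
IsStrictShape-decPart L r shape corner j with suc j ≟ r
... | yes refl =
  ≻-cong (sym (part-decPart-≡ L (suc j))) (sym (part-decPart-≢ L (suc j) (suc (suc j)) (1+n≢n ∘ sym)))
                        (shrink (part L (suc j)) (part L (suc (suc j))) corner)
  where
    shrink : ∀ a b → cornerᵇ a b ≡ true → a ∸ 1 ≻ b
    shrink (suc a) b corner with ∨-elim {b ≡ᵇ 0} (∧-elimʳ {1 ≤ᵇ suc a} corner)
    ... | inj₁ b≡0 = inj₂ (≡ᵇ-sound b≡0)
    ... | inj₂ far = inj₁ (≤-pred (subst (_≤ suc a) (+-comm b 2) (≤ᵇ-sound {b + 2} far)))
... | no sj≢r with suc (suc j) ≟ r
...   | yes refl =
  ≻-cong (sym (part-decPart-≢ L (suc (suc j)) (suc j) 1+n≢n)) (sym (part-decPart-≡ L (suc (suc j))))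
                          (shrink (shape j))
  where
    shrink : ∀ {a b} → a ≻ b → a ≻ b ∸ 1
    shrink (inj₁ b<a) = inj₁ (≤-<-trans (m∸n≤m _ 1) b<a)
    shrink (inj₂ b≡0) = inj₂ (cong (_∸ 1) b≡0)
...   | no ssj≢r = ≻-cong (sym (part-decPart-≢ L r (suc j) (sj≢r ∘ sym)))
                          (sym (part-decPart-≢ L r (suc (suc j)) (ssj≢r ∘ sym)))
                          (shape j)

-- Adding a northeast cell versus removing a corner

cornerᵇ-grown : ∀ x y → x ≻ y → cornerᵇ (suc x) y ≡ true
cornerᵇ-grown x y (inj₂ refl) = refl
cornerᵇ-grown x y (inj₁ y<x) = ∨-introʳ {y ≡ᵇ 0} (≤ᵇ-complete (subst (_≤ suc x) (+-comm 2 y) (s≤s y<x)))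

-- For consecutive rows of lengths x and y: growing row y by its NE cell keeps the corner of
-- row x iff removing that corner keeps the NE cell of row y.
cornerᵇ-grow-below : ∀ x y → (y + 2 ≤ᵇ x) ∧ cornerᵇ x (suc y) ≡ cornerᵇ x y ∧ (y + 2 ≤ᵇ x ∸ 1)
cornerᵇ-grow-below zero y =
  ≡-fromTrue (λ h → ⊥-elim (n≮0 {y + 1} (subst (_≤ 0) (+-suc y 1) (≤ᵇ-sound {y + 2} (∧-elimˡ h)))))
             (λ ())
cornerᵇ-grow-below (suc x) y = ≡-fromTrue ⇒ ⇐
  where
    ⇒ : (y + 2 ≤ᵇ suc x) ∧ cornerᵇ (suc x) (suc y) ≡ true → cornerᵇ (suc x) y ∧ (y + 2 ≤ᵇ x) ≡ true
    ⇒ h = ∧-intro (∨-introʳ {y ≡ᵇ 0} (∧-elimˡ h))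
                  (≤ᵇ-complete (≤-pred (≤ᵇ-sound {suc y + 2}
                    (∧-elimʳ {1 ≤ᵇ suc x} (∧-elimʳ {y + 2 ≤ᵇ suc x} h)))))
    ⇐ : cornerᵇ (suc x) y ∧ (y + 2 ≤ᵇ x) ≡ true → (y + 2 ≤ᵇ suc x) ∧ cornerᵇ (suc x) (suc y) ≡ true
    ⇐ h = ∧-intro (≤ᵇ-complete (≤-trans y+2≤x (n≤1+n x))) (≤ᵇ-complete {suc y + 2} (s≤s y+2≤x))
      where y+2≤x = ≤ᵇ-sound {y + 2} (∧-elimʳ {cornerᵇ (suc x) y} h)

module _ (L : List ℕ) (shape : IsStrictShape L) where

  hasCorner-incPart : ∀ r → r < length L → hasCorner (incPart (suc r) L) (suc r) ≡ true
  hasCorner-incPart r r<n =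
    trans (cong₂ cornerᵇ (part-incPart-≡ L r r<n)
                         (part-incPart-≢ L (suc r) (suc (suc r)) (λ e → 1+n≢n (sym e))))
          (cornerᵇ-grown _ _ (shape r))

  isNE-decPart : ∀ r → hasCorner L (suc r) ≡ true → isNE (decPart (suc r) L) (suc r) ≡ true
  isNE-decPart zero _ = refl
  isNE-decPart (suc r) corner =
    trans (cong₂ (λ a b → a + 2 ≤ᵇ b) (part-decPart-≡ L (suc (suc r)))
                 (part-decPart-≢ L (suc (suc r)) (suc r) (λ e → 1+n≢n e)))
          (still-NE (shape r) (hasCorner⇒nonEmpty L (suc (suc r)) corner))
    where
      still-NE : ∀ {p q} → p ≻ q → 1 ≤ q → (q ∸ 1 + 2 ≤ᵇ p) ≡ true
      still-NE {p} {suc q} (inj₁ q<p) _ = ≤ᵇ-complete (subst (_≤ p) (+-comm 2 q) q<p)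

isNE-hasCorner-comm : ∀ L i r → i < length L → i ≢ r →
  isNE L (suc i) ∧ hasCorner (incPart (suc i) L) (suc r) ≡ hasCorner L (suc r) ∧ isNE (decPart (suc r) L) (suc i)
isNE-hasCorner-comm L i r i<n i≢r with i ≟ suc r
... | yes refl =
  trans (cong₂ (λ u w → (part L (suc (suc r)) + 2 ≤ᵇ part L (suc r)) ∧ cornerᵇ u w)
               (part-incPart-≢ L (suc (suc r)) (suc r) (λ e → 1+n≢n e)) (part-incPart-≡ L (suc r) i<n))
  (trans (cornerᵇ-grow-below (part L (suc r)) (part L (suc (suc r))))
         (cong₂ (λ u w → hasCorner L (suc r) ∧ (u + 2 ≤ᵇ w))
                (sym (part-decPart-≢ L (suc r) (suc (suc r)) (λ e → 1+n≢n (sym e))))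
                (sym (part-decPart-≡ L (suc r)))))
... | no i≢sr =
  trans (cong (isNE L (suc i) ∧_)
              (cong₂ cornerᵇ (part-incPart-≢ L (suc i) (suc r) (λ e → i≢r (suc-injective e)))
                             (part-incPart-≢ L (suc i) (suc (suc r)) (λ e → i≢sr (suc-injective e)))))
  (trans (∧-comm (isNE L (suc i)) (hasCorner L (suc r)))
         (cong (hasCorner L (suc r) ∧_)
               (cong₂ (λ u w → (suc i ≡ᵇ 1) ∨ (u + 2 ≤ᵇ w))
                      (sym (part-decPart-≢ L (suc r) (suc i) (λ e → i≢r (sym (suc-injective e)))))
                      (sym (part-decPart-≢ L (suc r) i (λ e → i≢sr (sym e)))))))

module Exchange (L : List ℕ) (k : ℕ) (shape : IsStrictShape L) where

  n : ℕ
  n = length L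

  addThenRemove removeThenAdd : ℕ → ℕ → ℕ
  addThenRemove i r =
    ⟦ isNE L i ∧ (k <ᵇ i + part L i) ⟧ * (⟦ hasCorner (incPart i L) r ⟧ * g (decPart r (incPart i L)))
  removeThenAdd i r =
    ⟦ hasCorner L r ⟧
      * (⟦ isNE (decPart r L) i ∧ (k <ᵇ i + part (decPart r L) i) ⟧ * g (incPart i (decPart r L)))

  addedNE removedCorner : ℕ → ℕ
  addedNE r = ⟦ isNE L r ∧ (k <ᵇ r + part L r) ⟧ * g L
  removedCorner r = ⟦ hasCorner L r ∧ (k <ᵇ r + (part L r ∸ 1)) ⟧ * g L

  private
    addThenRemove-diagonal : ∀ r → r < n → addThenRemove (suc r) (suc r) ≡ addedNE (suc r)
    addThenRemove-diagonal r r<n =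
      cong (⟦ isNE L (suc r) ∧ (k <ᵇ suc r + part L (suc r)) ⟧ *_)
           (trans (cong₂ (λ u w → ⟦ u ⟧ * g w) (hasCorner-incPart L shape r r<n) (decPart-incPart L (suc r)))
                  (+-identityʳ _))

    removeThenAdd-diagonal : ∀ r → removeThenAdd (suc r) (suc r) ≡ removedCorner (suc r)
    removeThenAdd-diagonal r with hasCorner L (suc r) in corner
    ... | false = refl
    ... | true = trans (+-identityʳ _)
      (cong₂ (λ u w → ⟦ u ⟧ * g w)
        (cong₂ _∧_ (isNE-decPart L shape r corner) (cong (λ z → k <ᵇ suc r + z) (part-decPart-≡ L (suc r))))
        (incPart-decPart L (suc r) (hasCorner⇒nonEmpty L (suc r) corner)))

    addThenRemove≡removeThenAdd : ∀ i r → i < n → i ≢ r →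
      addThenRemove (suc i) (suc r) ≡ removeThenAdd (suc i) (suc r)
    addThenRemove≡removeThenAdd i r i<n i≢r = begin
        ⟦ ne ∧ kc ⟧ * (⟦ corner⁺ ⟧ * g (decPart R (incPart I L)))
      ≡⟨ sym (⟦∧⟧* (ne ∧ kc) corner⁺ _) ⟩
        ⟦ (ne ∧ kc) ∧ corner⁺ ⟧ * g (decPart R (incPart I L))
      ≡⟨ cong₂ (λ u w → ⟦ u ⟧ * g w) reorder (sym (incPart-decPart-comm L i r i≢r)) ⟩
        ⟦ corner ∧ (ne⁻ ∧ kc) ⟧ * g (incPart I (decPart R L))
      ≡⟨ ⟦∧⟧* corner (ne⁻ ∧ kc) _ ⟩
        ⟦ corner ⟧ * (⟦ ne⁻ ∧ kc ⟧ * g (incPart I (decPart R L)))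
      ≡⟨ cong (λ z → ⟦ corner ⟧ * (⟦ ne⁻ ∧ (k <ᵇ I + z) ⟧ * g (incPart I (decPart R L))))
              (sym (part-decPart-≢ L R I (λ e → i≢r (sym (suc-injective e))))) ⟩
        removeThenAdd I R
      ∎
      where
        open ≡-Reasoning
        I = suc i
        R = suc r
        ne = isNE L I
        kc = k <ᵇ I + part L I
        corner⁺ = hasCorner (incPart I L) R
        corner = hasCorner L R
        ne⁻ = isNE (decPart R L) I
        reorder : (ne ∧ kc) ∧ corner⁺ ≡ corner ∧ (ne⁻ ∧ kc)
        reorder = begin
          (ne ∧ kc) ∧ corner⁺   ≡⟨ ∧-assoc ne kc corner⁺ ⟩
          ne ∧ (kc ∧ corner⁺)   ≡⟨ cong (ne ∧_) (∧-comm kc corner⁺) ⟩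
          ne ∧ (corner⁺ ∧ kc)   ≡⟨ sym (∧-assoc ne corner⁺ kc) ⟩
          (ne ∧ corner⁺) ∧ kc   ≡⟨ cong (_∧ kc) (isNE-hasCorner-comm L i r i<n i≢r) ⟩
          (corner ∧ ne⁻) ∧ kc   ≡⟨ ∧-assoc corner ne⁻ kc ⟩
          corner ∧ (ne⁻ ∧ kc)   ∎

    exchange-pointwise : ∀ i r → i < n → r < n →
      addThenRemove (suc i) (suc r) + ⟦ suc i ≡ᵇ suc r ⟧ * removedCorner (suc r)
        ≡ removeThenAdd (suc i) (suc r) + ⟦ suc i ≡ᵇ suc r ⟧ * addedNE (suc r)
    exchange-pointwise i r i<n r<n with i ≟ r
    ... | yes refl rewrite ≡ᵇ-complete {i} refl | addThenRemove-diagonal r r<n | removeThenAdd-diagonal r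
                         | +-identityʳ (removedCorner (suc r)) | +-identityʳ (addedNE (suc r)) =
          +-comm (addedNE (suc r)) (removedCorner (suc r))
    ... | no i≢r rewrite ≡ᵇ-false i≢r = cong (_+ 0) (addThenRemove≡removeThenAdd i r i<n i≢r)

  exchange : ∑rows n (λ i → ∑rows n (addThenRemove i)) + ∑rows n removedCorner
           ≡ ∑rows n (λ i → ∑rows n (removeThenAdd i)) + ∑rows n addedNE
  exchange = begin
      ∑rows n (λ i → ∑rows n (addThenRemove i)) + ∑rows n removedCorner
    ≡⟨ cong (∑rows n (λ i → ∑rows n (addThenRemove i)) +_) (sym (∑rows-diagonal n removedCorner)) ⟩
      ∑rows n (λ i → ∑rows n (addThenRemove i))
        + ∑rows n (λ i → ∑rows n (λ r → ⟦ i ≡ᵇ r ⟧ * removedCorner r))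
    ≡⟨ sym (∑rows-+ n _ _) ⟩
      ∑rows n (λ i → ∑rows n (addThenRemove i) + ∑rows n (λ r → ⟦ i ≡ᵇ r ⟧ * removedCorner r))
    ≡⟨ ∑rows-cong n (λ i i<n → trans (sym (∑rows-+ n _ _))
                              (trans (∑rows-cong n (λ r r<n → exchange-pointwise i r i<n r<n))
                                     (∑rows-+ n _ _))) ⟩
      ∑rows n (λ i → ∑rows n (removeThenAdd i) + ∑rows n (λ r → ⟦ i ≡ᵇ r ⟧ * addedNE r))
    ≡⟨ ∑rows-+ n _ _ ⟩
      ∑rows n (λ i → ∑rows n (removeThenAdd i))
        + ∑rows n (λ i → ∑rows n (λ r → ⟦ i ≡ᵇ r ⟧ * addedNE r))
    ≡⟨ cong (∑rows n (λ i → ∑rows n (removeThenAdd i)) +_) (∑rows-diagonal n addedNE) ⟩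
      ∑rows n (λ i → ∑rows n (removeThenAdd i)) + ∑rows n addedNE
    ∎
    where open ≡-Reasoning

-- The telescoping step, for consecutive rows s+1 and s+2 of lengths l ≻ l'.
NE-corner-step : ∀ k s l l' → l ≻ l' → suc (suc s) ≤ k →
  ⟦ k <ᵇ suc s + l ⟧ + ⟦ (l' + 2 ≤ᵇ l) ∧ (k <ᵇ suc (suc s) + l') ⟧ ≡
  ⟦ cornerᵇ l l' ∧ (k <ᵇ suc s + l) ⟧ + ⟦ k <ᵇ suc (suc s) + l' ⟧
NE-corner-step k s l zero _ s+2≤k
  rewrite <ᵇ-false {k} {suc (suc s) + 0} (subst (_≤ k) (sym (+-identityʳ _)) s+2≤k) | ∧-zeroʳ (2 ≤ᵇ l) with l
... | zero rewrite <ᵇ-false {k} {suc s + 0} (subst (_≤ k) (sym (+-identityʳ _)) (≤-trans (n≤1+n _) s+2≤k)) = refl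
... | suc _ = refl
NE-corner-step k s l (suc y) (inj₂ ()) _
NE-corner-step k s l (suc y) (inj₁ y<l) _ with suc y + 2 ≤? l
... | yes far rewrite ≤ᵇ-complete far | ≤ᵇ-complete {1} {l} (≤-trans (s≤s z≤n) y<l) = refl
... | no ¬far with l | y<l
...   | suc (suc x) | s≤s (s≤s y≤x) with y ≟ x
...     | yes refl rewrite ¬-not {suc y + 2 ≤ᵇ suc (suc y)} (¬far ∘ ≤ᵇ-sound) =
          trans (+-identityʳ _) (cong (λ z → ⟦ k <ᵇ suc z ⟧) (+-suc s (suc y)))
...     | no y≢x =
          ⊥-elim (¬far (subst (_≤ suc (suc x)) (cong suc (+-comm 2 y)) (s≤s (s≤s (≤∧≢⇒< y≤x y≢x)))))

module CountingColumns (k : ℕ) where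

  private
    -- The rows of L placed as rows s+1, s+2, …; in countNEBelow the row above them has length p.
    countNEFrom countCornersFrom : ℕ → List ℕ → ℕ
    countNEFrom s L = ∑rows (length L) (λ j → ⟦ isNE L j ∧ (k <ᵇ (j + s) + part L j) ⟧)
    countCornersFrom s L = ∑rows (length L) (λ j → ⟦ hasCorner L j ∧ (k <ᵇ (j + s) + part L j) ⟧)

    countNEBelow : ℕ → ℕ → List ℕ → ℕ
    countNEBelow s p L =
      ∑rows (length L) (λ j → ⟦ (part L j + 2 ≤ᵇ part (p ∷ L) j) ∧ (k <ᵇ (j + s) + part L j) ⟧)

    countNEFrom-∷ : ∀ s l ls → countNEFrom s (l ∷ ls) ≡ ⟦ k <ᵇ suc s + l ⟧ + countNEBelow (suc s) l ls
    countNEFrom-∷ s l ls = cong (⟦ k <ᵇ suc s + l ⟧ +_) (∑rows-cong (length ls) (λ j _ →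
      cong (λ r → ⟦ (part ls (suc j) + 2 ≤ᵇ part (l ∷ ls) (suc j)) ∧ (k <ᵇ r + part ls (suc j)) ⟧)
           (sym (+-suc (suc j) s))))

    countNEBelow-∷ : ∀ s p l ls →
      countNEBelow s p (l ∷ ls) ≡ ⟦ (l + 2 ≤ᵇ p) ∧ (k <ᵇ suc s + l) ⟧ + countNEBelow (suc s) l ls
    countNEBelow-∷ s p l ls = cong (⟦ (l + 2 ≤ᵇ p) ∧ (k <ᵇ suc s + l) ⟧ +_) (∑rows-cong (length ls) (λ j _ →
      cong (λ r → ⟦ (part ls (suc j) + 2 ≤ᵇ part (l ∷ ls) (suc j)) ∧ (k <ᵇ r + part ls (suc j)) ⟧)
           (sym (+-suc (suc j) s))))

    countCornersFrom-∷ : ∀ s l ls →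
      countCornersFrom s (l ∷ ls) ≡ ⟦ cornerᵇ l (part ls 1) ∧ (k <ᵇ suc s + l) ⟧ + countCornersFrom (suc s) ls
    countCornersFrom-∷ s l ls = cong (⟦ cornerᵇ l (part ls 1) ∧ (k <ᵇ suc s + l) ⟧ +_)
      (∑rows-cong (length ls) λ j _ →
        cong (λ r → ⟦ hasCorner ls (suc j) ∧ (k <ᵇ r + part ls (suc j)) ⟧) (sym (+-suc (suc j) s)))

    countNEFrom≡countCornersFrom : ∀ s L → IsStrictShape L → s + length L ≤ k →
      countNEFrom s L ≡ countCornersFrom s L
    countNEFrom≡countCornersFrom s [] _ _ = refl
    countNEFrom≡countCornersFrom s (l ∷ []) _ s+1≤k =
      trans (countNEFrom-∷ s l []) (trans (last-row l) (sym (countCornersFrom-∷ s l [])))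
      where
        last-row : ∀ l → ⟦ k <ᵇ suc s + l ⟧ + 0 ≡ ⟦ cornerᵇ l 0 ∧ (k <ᵇ suc s + l) ⟧ + 0
        last-row zero
          rewrite <ᵇ-false {k} {suc s + 0} (subst (_≤ k) (trans (+-comm s 1) (sym (+-identityʳ _))) s+1≤k) = refl
        last-row (suc _) = refl
    countNEFrom≡countCornersFrom s (l ∷ l' ∷ ls) shape s+n≤k = begin
        countNEFrom s (l ∷ l' ∷ ls)
      ≡⟨ countNEFrom-∷ s l (l' ∷ ls) ⟩
        ⟦ k <ᵇ suc s + l ⟧ + countNEBelow (suc s) l (l' ∷ ls)
      ≡⟨ cong (⟦ k <ᵇ suc s + l ⟧ +_) (countNEBelow-∷ (suc s) l l' ls) ⟩
        ⟦ k <ᵇ suc s + l ⟧ + (⟦ (l' + 2 ≤ᵇ l) ∧ (k <ᵇ suc (suc s) + l') ⟧ + rest)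
      ≡⟨ sym (+-assoc ⟦ k <ᵇ suc s + l ⟧ ⟦ (l' + 2 ≤ᵇ l) ∧ (k <ᵇ suc (suc s) + l') ⟧ rest) ⟩
        ⟦ k <ᵇ suc s + l ⟧ + ⟦ (l' + 2 ≤ᵇ l) ∧ (k <ᵇ suc (suc s) + l') ⟧ + rest
      ≡⟨ cong (_+ rest) (NE-corner-step k s l l' (shape 0) s+2≤k) ⟩
        ⟦ cornerᵇ l l' ∧ (k <ᵇ suc s + l) ⟧ + ⟦ k <ᵇ suc (suc s) + l' ⟧ + rest
      ≡⟨ +-assoc ⟦ cornerᵇ l l' ∧ (k <ᵇ suc s + l) ⟧ ⟦ k <ᵇ suc (suc s) + l' ⟧ rest ⟩
        ⟦ cornerᵇ l l' ∧ (k <ᵇ suc s + l) ⟧ + (⟦ k <ᵇ suc (suc s) + l' ⟧ + rest)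
      ≡⟨ cong (⟦ cornerᵇ l l' ∧ (k <ᵇ suc s + l) ⟧ +_) (sym (countNEFrom-∷ (suc s) l' ls)) ⟩
        ⟦ cornerᵇ l l' ∧ (k <ᵇ suc s + l) ⟧ + countNEFrom (suc s) (l' ∷ ls)
      ≡⟨ cong (⟦ cornerᵇ l l' ∧ (k <ᵇ suc s + l) ⟧ +_)
              (countNEFrom≡countCornersFrom (suc s) (l' ∷ ls) (shape ∘ suc) s+1+n≤k) ⟩
        ⟦ cornerᵇ l l' ∧ (k <ᵇ suc s + l) ⟧ + countCornersFrom (suc s) (l' ∷ ls)
      ≡⟨ sym (countCornersFrom-∷ s l (l' ∷ ls)) ⟩
        countCornersFrom s (l ∷ l' ∷ ls)
      ∎
      where
        open ≡-Reasoning
        rest = countNEBelow (suc (suc s)) l' ls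
        s+1+n≤k : suc s + length (l' ∷ ls) ≤ k
        s+1+n≤k = subst (_≤ k) (+-suc s _) s+n≤k
        s+2≤k : suc (suc s) ≤ k
        s+2≤k = ≤-trans (≤-trans (s≤s (s≤s (m≤m+n s (length ls))))
                                 (≤-reflexive (sym (trans (+-suc s _) (cong suc (+-suc s _))))))
                        s+n≤k

  #NE>k≡#corners≥k : ∀ L → IsStrictShape L → length L ≤ k →
    ∑rows (length L) (λ r → ⟦ isNE L r ∧ (k <ᵇ r + part L r) ⟧)
      ≡ ∑rows (length L) (λ r → ⟦ hasCorner L r ∧ (k <ᵇ r + part L r) ⟧)
  #NE>k≡#corners≥k L shape n≤k =
    trans (∑rows-cong (length L) (λ j _ → cong (λ r → ⟦ isNE L (suc j) ∧ (k <ᵇ r + part L (suc j)) ⟧)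
                                                (sym (+-identityʳ (suc j)))))
    (trans (countNEFrom≡countCornersFrom 0 L shape n≤k)
           (∑rows-cong (length L) (λ j _ → cong (λ r → ⟦ hasCorner L (suc j) ∧ (k <ᵇ r + part L (suc j)) ⟧)
                                                 (+-identityʳ (suc j)))))

part-empty : ∀ L → sum L ≡ 0 → ∀ j → part L j ≡ 0
part-empty [] _ j = refl
part-empty (l ∷ ls) _ zero = refl
part-empty (l ∷ ls) |L|≡0 (suc zero) = m+n≡0⇒m≡0 l |L|≡0
part-empty (l ∷ ls) |L|≡0 (suc (suc j)) = part-empty ls (m+n≡0⇒n≡0 l |L|≡0) (suc j)

shiftedFrom-empty : ∀ s L → sum L ≡ 0 → shiftedFrom s L ≡ []
shiftedFrom-empty s [] _ = refl
shiftedFrom-empty s (l ∷ ls) |L|≡0 rewrite m+n≡0⇒m≡0 l |L|≡0 =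
  shiftedFrom-empty (suc s) ls (m+n≡0⇒n≡0 l |L|≡0)

gPlus-empty : ∀ L k → sum L ≡ 0 → gPlus L k ≡ 0
gPlus-empty L k |L|≡0 = cong (λ D → countB (isSBTcol k D) (fillings D (suc (sum L)))) (shiftedFrom-empty 1 L |L|≡0)

neSum-empty : ∀ L k → sum L ≡ 0 → length L ≤ k → neSum L k ≡ 0
neSum-empty L k |L|≡0 n≤k = trans (neSum-rows L k) (∑rows-zero (length L) no-column>k)
  where
    no-column>k : ∀ j → j < length L →
      ⟦ isNE L (suc j) ∧ (k <ᵇ suc j + part L (suc j)) ⟧ * g (incPart (suc j) L) ≡ 0
    no-column>k j j<n = cong (λ b → ⟦ b ⟧ * g (incPart (suc j) L))
      (trans (cong (λ z → isNE L (suc j) ∧ (k <ᵇ suc j + z)) (part-empty L |L|≡0 (suc j)))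
      (trans (cong (isNE L (suc j) ∧_) (<ᵇ-false (subst (_≤ k) (sym (+-identityʳ _)) (≤-trans j<n n≤k))))
             (∧-zeroʳ (isNE L (suc j)))))

module Step (L : List ℕ) (k : ℕ) (shape : IsStrictShape L) (n≤k : length L ≤ k) where
  open Exchange L k shape public
  open CountingColumns k

  cornerInColumnK : ℕ → ℕ
  cornerInColumnK r = ⟦ hasCorner L r ⟧ * (⟦ (r + (part L r ∸ 1)) ≡ᵇ k ⟧ * g L)

  gPlus-expansion :
    (∀ r → hasCorner L (suc r) ≡ true → gPlus (decPart (suc r) L) k ≡ neSum (decPart (suc r) L) k) →
    gPlus L k ≡ ∑rows n (λ i → ∑rows n (removeThenAdd i)) + ∑rows n cornerInColumnK
  gPlus-expansion IH = begin
      gPlus L k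
    ≡⟨ gPlus-corners L k shape ⟩
      ∑rows n (λ r → ⟦ hasCorner L r ⟧ * (gPlus (decPart r L) k + ⟦ (r + (part L r ∸ 1)) ≡ᵇ k ⟧ * g L))
    ≡⟨ ∑rows-cong n (λ r _ → trans (*-distribˡ-+ ⟦ hasCorner L (suc r) ⟧ _ _)
                                   (cong (_+ cornerInColumnK (suc r)) (IH′ r))) ⟩
      ∑rows n (λ r → ⟦ hasCorner L r ⟧ * neSum (decPart r L) k + cornerInColumnK r)
    ≡⟨ ∑rows-+ n _ cornerInColumnK ⟩
      ∑rows n (λ r → ⟦ hasCorner L r ⟧ * neSum (decPart r L) k) + ∑rows n cornerInColumnK
    ≡⟨ cong (_+ ∑rows n cornerInColumnK)
            (trans (∑rows-cong n expand) (∑rows-comm n n (λ r i → removeThenAdd i r))) ⟩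
      ∑rows n (λ i → ∑rows n (removeThenAdd i)) + ∑rows n cornerInColumnK
    ∎
    where
      open ≡-Reasoning
      IH′ : ∀ r → ⟦ hasCorner L (suc r) ⟧ * gPlus (decPart (suc r) L) k
                ≡ ⟦ hasCorner L (suc r) ⟧ * neSum (decPart (suc r) L) k
      IH′ r with hasCorner L (suc r) in corner
      ... | true = cong (_+ 0) (IH r corner)
      ... | false = refl
      expand : ∀ r → r < n →
        ⟦ hasCorner L (suc r) ⟧ * neSum (decPart (suc r) L) k ≡ ∑rows n (λ i → removeThenAdd i (suc r))
      expand r _ = trans (cong (⟦ hasCorner L (suc r) ⟧ *_)
                           (trans (neSum-rows L⁻ k) (cong (λ m → ∑rows m addNE) (length-decPart L (suc r)))))
                         (sym (∑rows-*ˡ n ⟦ hasCorner L (suc r) ⟧ addNE))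
        where
          L⁻ = decPart (suc r) L
          addNE : ℕ → ℕ
          addNE i = ⟦ isNE L⁻ i ∧ (k <ᵇ i + part L⁻ i) ⟧ * g (incPart i L⁻)

  neSum-expansion : neSum L k ≡ ∑rows n (λ i → ∑rows n (addThenRemove i))
  neSum-expansion = trans (neSum-rows L k) (∑rows-cong n expand)
    where
      expand : ∀ i → i < n → ⟦ isNE L (suc i) ∧ (k <ᵇ suc i + part L (suc i)) ⟧ * g (incPart (suc i) L)
                             ≡ ∑rows n (addThenRemove (suc i))
      expand i i<n with isNE L (suc i) ∧ (k <ᵇ suc i + part L (suc i)) in addable
      ... | false = sym (∑rows-zero n (λ _ _ → refl))
      ... | true = trans (cong (1 *_)
                     (trans (g-corners L⁺ (sum L) (sum-incPart L i i<n)
                               (IsStrictShape-incPart L i shape i<n (∧-elimˡ addable)))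
                            (cong (λ m → ∑rows m removeCorner) (length-incPart L (suc i)))))
                         (sym (∑rows-*ˡ n 1 removeCorner))
        where
          L⁺ = incPart (suc i) L
          removeCorner : ℕ → ℕ
          removeCorner r = ⟦ hasCorner L⁺ r ⟧ * g (decPart r L⁺)

  counting : ∑rows n addedNE ≡ ∑rows n removedCorner + ∑rows n cornerInColumnK
  counting = begin
      ∑rows n addedNE
    ≡⟨ ∑rows-*ʳ n _ (g L) ⟩
      ∑rows n (λ r → ⟦ isNE L r ∧ (k <ᵇ r + part L r) ⟧) * g L
    ≡⟨ cong (_* g L) (#NE>k≡#corners≥k L shape n≤k) ⟩
      ∑rows n (λ r → ⟦ hasCorner L r ∧ (k <ᵇ r + part L r) ⟧) * g L
    ≡⟨ sym (∑rows-*ʳ n _ (g L)) ⟩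
      ∑rows n (λ r → ⟦ hasCorner L r ∧ (k <ᵇ r + part L r) ⟧ * g L)
    ≡⟨ sym (∑rows-cong n (λ r _ → corner-column (hasCorner L (suc r)) (part L (suc r)) (suc r)
                                     (hasCorner⇒nonEmpty L (suc r)))) ⟩
      ∑rows n (λ r → removedCorner r + cornerInColumnK r)
    ≡⟨ ∑rows-+ n removedCorner cornerInColumnK ⟩
      ∑rows n removedCorner + ∑rows n cornerInColumnK
    ∎
    where
      open ≡-Reasoning
      corner-column : ∀ c a r → (c ≡ true → 1 ≤ a) →
        ⟦ c ∧ (k <ᵇ r + (a ∸ 1)) ⟧ * g L + ⟦ c ⟧ * (⟦ (r + (a ∸ 1)) ≡ᵇ k ⟧ * g L)
          ≡ ⟦ c ∧ (k <ᵇ r + a) ⟧ * g L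
      corner-column false a r _ = refl
      corner-column true (suc a) r _ = begin
          ⟦ k <ᵇ r + a ⟧ * g L + (⟦ r + a ≡ᵇ k ⟧ * g L + 0)
        ≡⟨ cong (⟦ k <ᵇ r + a ⟧ * g L +_) (+-identityʳ _) ⟩
          ⟦ k <ᵇ r + a ⟧ * g L + ⟦ r + a ≡ᵇ k ⟧ * g L
        ≡⟨ sym (*-distribʳ-+ (g L) ⟦ k <ᵇ r + a ⟧ ⟦ r + a ≡ᵇ k ⟧) ⟩
          (⟦ k <ᵇ r + a ⟧ + ⟦ r + a ≡ᵇ k ⟧) * g L
        ≡⟨ cong (_* g L) (trans (⟦<ᵇ⟧+⟦≡ᵇ⟧ k (r + a)) (cong (λ m → ⟦ k <ᵇ m ⟧) (sym (+-suc r a)))) ⟩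
          ⟦ k <ᵇ r + suc a ⟧ * g L
        ∎
      corner-column true zero r nonEmpty with () ← nonEmpty refl

gPlus≡neSum : ∀ k M L → sum L ≡ M → IsStrictShape L → length L ≤ k → gPlus L k ≡ neSum L k
gPlus≡neSum k zero L |L|≡0 _ n≤k = trans (gPlus-empty L k |L|≡0) (sym (neSum-empty L k |L|≡0 n≤k))
gPlus≡neSum k (suc M) L |L|≡ shape n≤k = +-cancelʳ-≡ Σremoved (gPlus L k) (neSum L k) (begin
    gPlus L k + Σremoved
  ≡⟨ cong (_+ Σremoved) (gPlus-expansion IH) ⟩
    ΣremoveThenAdd + ΣinColumnK + Σremoved
  ≡⟨ +-assoc ΣremoveThenAdd ΣinColumnK Σremoved ⟩
    ΣremoveThenAdd + (ΣinColumnK + Σremoved)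
  ≡⟨ cong (ΣremoveThenAdd +_) (trans (+-comm ΣinColumnK Σremoved) (sym counting)) ⟩
    ΣremoveThenAdd + ∑rows n addedNE
  ≡⟨ sym exchange ⟩
    ∑rows n (λ i → ∑rows n (addThenRemove i)) + Σremoved
  ≡⟨ cong (_+ Σremoved) (sym neSum-expansion) ⟩
    neSum L k + Σremoved
  ∎)
  where
    open Step L k shape n≤k
    open ≡-Reasoning
    Σremoved = ∑rows n removedCorner
    ΣinColumnK = ∑rows n cornerInColumnK
    ΣremoveThenAdd = ∑rows n (λ i → ∑rows n (removeThenAdd i))
    IH : ∀ r → hasCorner L (suc r) ≡ true → gPlus (decPart (suc r) L) k ≡ neSum (decPart (suc r) L) k
    IH r corner = gPlus≡neSum k M (decPart (suc r) L)
      (suc-injective (trans (sum-decPart L r (hasCorner⇒nonEmpty L (suc r) corner)) |L|≡))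
      (IsStrictShape-decPart L (suc r) shape corner)
      (subst (_≤ k) (sym (length-decPart L (suc r))) n≤k)

lemma3p1 : (l₁ : ℕ) (ls : List ℕ) (k : ℕ) →
    IsStrictPartition (l₁ ∷ ls) →
    length (l₁ ∷ ls) ≤ k → k ≤ l₁ →
    gPlus (l₁ ∷ ls) k ≡ neSum (l₁ ∷ ls) k
lemma3p1 l₁ ls k strict n≤k _ =
  gPlus≡neSum k (sum (l₁ ∷ ls)) (l₁ ∷ ls) refl (IsStrictPartition⇒IsStrictShape strict) n≤k
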